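{- Let $\mathbb{F}$ be any field and let $X$ and $Y$ be $n\times n$ matrices of variables. Let $\mathcal{F}$ be the system of equations $\det(X)=0$, $XY-I_n=0$. Then: (1) there is a depth-three $\det_n$-oracle circuit with $O(n^2)$ wires that computes an IPS refutation of $\mathcal{F}$; (2) there is a depth-three $(\det_n+O(\varepsilon))$-oracle circuit with $O(n^2)$ wires that computes $C+O(\varepsilon)$ for some IPS refutation $C$ of $\mathcal{F}$.
   Context: An IPS refutation of a system $f_1=\dots=f_k=0$ of polynomials in $\vec x$ is a polynomial $C(\vec x,y_1,\dots,y_k)$ with $C(\vec x,\vec 0)=0$ and $C(\vec x,f_1(\vec x),\dots,f_k(\vec x))=1$ (here there is one placeholder variable for $\det(X)$ and an $n\times n$ matrix of placeholder variables for $XY-I_n$). A $g$-oracle circuit may use gates computing $g$ of their inputs. $\varepsilon$ is an indeterminate; a $(\det_n+O(\varepsilon))$-oracle is a gate computing some fixed $h(X,\varepsilon)\in\mathbb{F}[[\varepsilon]][X]$ with $h=\det_n(X)+\varepsilon g$, $g\in\mathbb{F}[[\varepsilon]][X]$, and "computes $C+O(\varepsilon)$" means computing $C+\varepsilon g'$ with $g'$ a power-series-coefficient polynomial. -}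

module Defs where

open import Level using (Level; _⊔_) renaming (suc to lsuc)
open import Algebra.Bundles using (CommutativeRing)
open import Algebra.Bundles.Raw using (RawRing)
open import Data.Nat using (ℕ; zero; suc; _∸_) renaming (_⊔_ to _⊔ℕ_; _+_ to _+ℕ_; _*_ to _*ℕ_)
open import Data.Fin using (Fin; zero; suc; punchIn; _≟_)
open import Data.List using (List; []; _∷_; foldr; length)
open import Data.Product using (Σ; _×_; _,_)
open import Data.Sum using (_⊎_; inj₁; inj₂; [_,_])
open import Data.Unit using (⊤; tt)
open import Relation.Nullary using (¬_; yes; no)

record Field (c ℓ : Level) : Set (lsuc (c ⊔ ℓ)) where
  field
    commutativeRing : CommutativeRing c ℓ
  open CommutativeRing commutativeRing public
  field
    0≉1     : ¬ (0# ≈ 1#)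
    inverse : ∀ x → ¬ (x ≈ 0#) → Σ Carrier (λ y → (x * y) ≈ 1#)

-- Polynomials over a coefficient ring R in variables from A:
-- terms modulo the congruence generated by the commutative-ring laws
-- and the laws making  con : R → R[A]  a ring homomorphism.
-- For R a commutative ring this is exactly the polynomial ring R[A].

module Poly {c ℓ : Level} (R : RawRing c ℓ) where
  open RawRing R

  infixl 6 _⊕_
  infixl 7 _⊗_
  infix  8 ⊖_
  infix  4 _≃_

  data Expr (A : Set) : Set c where
    var : A → Expr A
    con : Carrier → Expr A
    _⊕_ : Expr A → Expr A → Expr A
    _⊗_ : Expr A → Expr A → Expr A
    ⊖_  : Expr A → Expr A

  data _≃_ {A : Set} : Expr A → Expr A → Set (c ⊔ ℓ) where
    ≃-refl  : ∀ {p} → p ≃ p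
    ≃-sym   : ∀ {p q} → p ≃ q → q ≃ p
    ≃-trans : ∀ {p q r} → p ≃ q → q ≃ r → p ≃ r
    ⊕-cong  : ∀ {p p' q q'} → p ≃ p' → q ≃ q' → p ⊕ q ≃ p' ⊕ q'
    ⊗-cong  : ∀ {p p' q q'} → p ≃ p' → q ≃ q' → p ⊗ q ≃ p' ⊗ q'
    ⊖-cong  : ∀ {p q} → p ≃ q → ⊖ p ≃ ⊖ q
    ⊕-assoc : ∀ p q r → (p ⊕ q) ⊕ r ≃ p ⊕ (q ⊕ r)
    ⊕-comm  : ∀ p q → p ⊕ q ≃ q ⊕ p
    ⊕-idʳ   : ∀ p → p ⊕ con 0# ≃ p
    ⊖-invʳ  : ∀ p → p ⊕ ⊖ p ≃ con 0#
    ⊗-assoc : ∀ p q r → (p ⊗ q) ⊗ r ≃ p ⊗ (q ⊗ r)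
    ⊗-comm  : ∀ p q → p ⊗ q ≃ q ⊗ p
    ⊗-idʳ   : ∀ p → p ⊗ con 1# ≃ p
    distribˡ : ∀ p q r → p ⊗ (q ⊕ r) ≃ (p ⊗ q) ⊕ (p ⊗ r)
    con-cong : ∀ {a b} → a ≈ b → con a ≃ con b
    con-+   : ∀ a b → con (a + b) ≃ con a ⊕ con b
    con-*   : ∀ a b → con (a * b) ≃ con a ⊗ con b
    con-neg : ∀ a → con (- a) ≃ ⊖ con a

  substE : {A B : Set} → (A → Expr B) → Expr A → Expr B
  substE σ (var x) = σ x
  substE σ (con a) = con a
  substE σ (p ⊕ q) = substE σ p ⊕ substE σ q
  substE σ (p ⊗ q) = substE σ p ⊗ substE σ q
  substE σ (⊖ p)   = ⊖ substE σ p

  sumE : {A : Set} {m : ℕ} → (Fin m → Expr A) → Expr A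
  sumE {m = zero}  f = con 0#
  sumE {m = suc m} f = f zero ⊕ sumE (λ i → f (suc i))

  signed : {A : Set} → ℕ → Expr A → Expr A
  signed zero    p = p
  signed (suc k) p = ⊖ signed k p

  det : {A : Set} (n : ℕ) → (Fin n → Fin n → Expr A) → Expr A
  det zero    M = con 1#
  det (suc n) M =
    sumE (λ j → signed (Data.Fin.toℕ j)
                  (M zero j ⊗ det n (λ i k → M (suc i) (punchIn j k))))

  detPoly : (n : ℕ) → Expr (Fin n × Fin n)
  detPoly n = det n (λ i j → var (i , j))

mapCoeff : {c ℓ c' ℓ' : Level} {R : RawRing c ℓ} {S : RawRing c' ℓ'} {A : Set} →
           (RawRing.Carrier R → RawRing.Carrier S) → Poly.Expr R A → Poly.Expr S A
mapCoeff φ (Poly.var x) = Poly.var x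
mapCoeff φ (Poly.con a) = Poly.con (φ a)
mapCoeff {R = R} {S} φ (p Poly.⊕ q) = Poly._⊕_ {R = S} (mapCoeff {R = R} {S} φ p) (mapCoeff {R = R} {S} φ q)
mapCoeff {R = R} {S} φ (p Poly.⊗ q) = Poly._⊗_ {R = S} (mapCoeff {R = R} {S} φ p) (mapCoeff {R = R} {S} φ q)
mapCoeff {R = R} {S} φ (Poly.⊖ p)   = Poly.⊖_ {R = S} (mapCoeff {R = R} {S} φ p)

module PowerSeries {c ℓ : Level} (F : Field c ℓ) where
  open Field F

  Σ≤ : ℕ → (ℕ → Carrier) → Carrier
  Σ≤ zero    t = t 0
  Σ≤ (suc k) t = Σ≤ k t + t (suc k)

  PSRing : RawRing c ℓ
  PSRing = record
    { Carrier = ℕ → Carrier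
    ; _≈_     = λ f g → ∀ k → f k ≈ g k
    ; _+_     = λ f g k → f k + g k
    ; _*_     = λ f g k → Σ≤ k (λ i → f i * g (k ∸ i))
    ; -_      = λ f k → - f k
    ; 0#      = λ _ → 0#
    ; 1#      = λ { zero → 1# ; (suc _) → 0# }
    }

  ε : ℕ → Carrier
  ε (suc zero) = 1#
  ε _          = 0#

  ι : Carrier → ℕ → Carrier
  ι a zero    = a
  ι a (suc _) = 0#

-- K : constants, A : input variables, n : the oracle gate has n×n inputs.
-- A gate in a circuit with m earlier gates reads earlier gates (Fin m)
-- or input variables (A).

module Circuits {k : Level} (K : Set k) (n : ℕ) (A : Set) where

  Input : ℕ → Set
  Input m = Fin m ⊎ A

  data Gate (m : ℕ) : Set k where
    -- affine sum gate:  a₀ + Σ aᵢ·wᵢ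
    add : K → List (K × Input m) → Gate m
    mul : List (Input m) → Gate m
    orc : (Fin n → Fin n → Input m) → Gate m

  -- gates listed newest first; gate g ∷ C may read any gate of C
  data Gates : ℕ → Set k where
    []  : Gates 0
    _∷_ : ∀ {m} → Gate m → Gates m → Gates (suc m)

  record Circuit : Set k where
    field
      size   : ℕ
      gates  : Gates size
      output : Input size

  gateWires : ∀ {m} → Gate m → ℕ
  gateWires (add _ ws) = length ws
  gateWires (mul ws)   = length ws
  gateWires (orc _)    = n *ℕ n

  gatesWires : ∀ {m} → Gates m → ℕ
  gatesWires []       = 0
  gatesWires (g ∷ gs) = gateWires g +ℕ gatesWires gs

  wires : Circuit → ℕ
  wires C = gatesWires (Circuit.gates C)

  maxFin : ∀ {m} → (Fin m → ℕ) → ℕ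
  maxFin {zero}  f = 0
  maxFin {suc m} f = f zero ⊔ℕ maxFin (λ i → f (suc i))

  inDepth : ∀ {m} → (Fin m → ℕ) → Input m → ℕ
  inDepth d (inj₁ i) = d i
  inDepth d (inj₂ _) = 0

  gateDepth : ∀ {m} → (Fin m → ℕ) → Gate m → ℕ
  gateDepth d (add _ ws) = suc (foldr (λ w r → inDepth d (Data.Product.proj₂ w) ⊔ℕ r) 0 ws)
  gateDepth d (mul ws)   = suc (foldr (λ w r → inDepth d w ⊔ℕ r) 0 ws)
  gateDepth d (orc M)    = suc (maxFin (λ i → maxFin (λ j → inDepth d (M i j))))

  depths : ∀ {m} → Gates m → Fin m → ℕ
  depths (g ∷ gs) zero    = gateDepth (depths gs) g
  depths (g ∷ gs) (suc i) = depths gs i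

  depth : Circuit → ℕ
  depth C = maxFin (depths (Circuit.gates C))
            ⊔ℕ inDepth (depths (Circuit.gates C)) (Circuit.output C)

  module Semantics {c ℓ : Level} (S : RawRing c ℓ)
                   (κ : K → RawRing.Carrier S)
                   (h : Poly.Expr S (Fin n × Fin n)) where
    open Poly S

    inVal : ∀ {m} → (Fin m → Expr A) → Input m → Expr A
    inVal v (inj₁ i) = v i
    inVal v (inj₂ x) = var x

    gateVal : ∀ {m} → (Fin m → Expr A) → Gate m → Expr A
    gateVal v (add a ws) =
      con (κ a) ⊕ foldr (λ w r → (con (κ (Data.Product.proj₁ w)) ⊗ inVal v (Data.Product.proj₂ w)) ⊕ r)
                        (con (RawRing.0# S)) ws
    gateVal v (mul ws) = foldr (λ w r → inVal v w ⊗ r) (con (RawRing.1# S)) ws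
    gateVal v (orc M)  = substE (λ { (i , j) → inVal v (M i j) }) h

    values : ∀ {m} → Gates m → Fin m → Expr A
    values (g ∷ gs) zero    = gateVal (values gs) g
    values (g ∷ gs) (suc i) = values gs i

    computes : Circuit → Expr A
    computes C = inVal (values (Circuit.gates C)) (Circuit.output C)

module IPS {c ℓ : Level} (R : RawRing c ℓ) where
  open Poly R

  IsIPSRefutation : {X P : Set} → (P → Expr X) → Expr (X ⊎ P) → Set (c ⊔ ℓ)
  IsIPSRefutation f C =
    (substE [ var , (λ _ → con (RawRing.0# R)) ] C ≃ con (RawRing.0# R))
    × (substE [ var , f ] C ≃ con (RawRing.1# R))

-- variables: inj₁ (i , j) = X_ij, inj₂ (i , j) = Y_ij
XYVar : ℕ → Set
XYVar n = (Fin n × Fin n) ⊎ (Fin n × Fin n)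

-- placeholder variables: inj₁ tt for det(X), inj₂ (i , j) for (XY - I)_ij
PVar : ℕ → Set
PVar n = ⊤ ⊎ (Fin n × Fin n)

module DetSystem {c ℓ : Level} (R : RawRing c ℓ) (n : ℕ) where
  open Poly R

  δ : Fin n → Fin n → Expr (XYVar n)
  δ i j with i ≟ j
  ... | yes _ = con (RawRing.1# R)
  ... | no _  = con (RawRing.0# R)

  system : PVar n → Expr (XYVar n)
  system (inj₁ tt) = det n (λ i j → var (inj₁ (i , j)))
  system (inj₂ (i , j)) =
    sumE (λ k → var (inj₁ (i , k)) ⊗ var (inj₂ (k , j))) ⊕ ⊖ δ i j

open import Data.Nat using (_≤_; _^_)
open import Data.Product using (∃)

module Prop87 {c ℓ : Level} (F : Field c ℓ) where
  open Field F using (Carrier; rawRing)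
  open PowerSeries F using (PSRing; ε; ι)

  Vars : ℕ → Set
  Vars n = XYVar n ⊎ PVar n

  Claim1 : Set (c ⊔ ℓ)
  Claim1 =
    ∃ λ (a : ℕ) → (n : ℕ) →
      Σ (Circuits.Circuit Carrier n (Vars n)) λ D →
        (Circuits.depth Carrier n (Vars n) D ≤ 3)
        × (Circuits.wires Carrier n (Vars n) D ≤ a *ℕ (n ^ 2) +ℕ a)
        × Σ (Poly.Expr rawRing (Vars n)) λ C →
            IPS.IsIPSRefutation rawRing (DetSystem.system rawRing n) C
            × Poly._≃_ rawRing
                (Circuits.Semantics.computes Carrier n (Vars n) rawRing (λ x → x)
                   (Poly.detPoly rawRing n) D)
                C

  Claim2 : Set (c ⊔ ℓ)
  Claim2 =
    ∃ λ (a : ℕ) → (n : ℕ) →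
      (h g : Poly.Expr PSRing (Fin n × Fin n)) →
      Poly._≃_ PSRing h
        (Poly._⊕_ {R = PSRing} (Poly.detPoly PSRing n) (Poly._⊗_ {R = PSRing} (Poly.con ε) g)) →
      Σ (Circuits.Circuit Carrier n (Vars n)) λ D →
        (Circuits.depth Carrier n (Vars n) D ≤ 3)
        × (Circuits.wires Carrier n (Vars n) D ≤ a *ℕ (n ^ 2) +ℕ a)
        × Σ (Poly.Expr rawRing (Vars n)) λ C →
            IPS.IsIPSRefutation rawRing (DetSystem.system rawRing n) C
            × Σ (Poly.Expr PSRing (Vars n)) λ g' →
                Poly._≃_ PSRing
                  (Circuits.Semantics.computes Carrier n (Vars n) PSRing ι h D)
                  (Poly._⊕_ {R = PSRing} (mapCoeff {R = rawRing} {S = PSRing} ι C)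
                     (Poly._⊗_ {R = PSRing} (Poly.con ε) g'))

-- The circuit outputs C = 1 + z · det Y − det (I + Z), where z and Z are the placeholders for
-- det X and XY − I. Setting the placeholders to zero gives 1 − det I = 0; substituting the
-- equations gives 1 + det X · det Y − det (XY) = 1. The substance is det (XY) = det X · det Y
-- over an arbitrary commutative ring: det, defined by expansion along the first row, is
-- multilinear and alternating in the rows, and every such form f satisfies f A = det A · f I
-- (expand f A along the first row, clear the column of each term, and induct on the size).
-- With an oracle det + ε g the same circuit computes C + ε (z · g Y − g (I + Z)).

module Submission where

open import Level using (Level; _⊔_)
open import Algebra.Bundles using (CommutativeRing)
open import Algebra.Bundles.Raw using (RawRing)
open import Algebra.Structures using (IsCommutativeRing)
open import Data.Bool using (Bool; true; false; not; if_then_else_)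
open import Data.Bool.Properties using (T-≡)
open import Data.Empty using (⊥-elim)
open import Data.Fin using (Fin; toℕ; punchIn; fromℕ<; _≟_) renaming (zero to fzero; suc to fsuc)
import Data.Fin.Properties as Finₚ
open import Data.List using ([]; _∷_)
open import Data.Nat as ℕ
  using (ℕ; zero; suc; pred; _<_; _≤_; _<ᵇ_; z≤n; s≤s; z<s; s<s; _^_) renaming (_+_ to _+ℕ_; _*_ to _*ℕ_)
import Data.Nat.Properties as ℕₚ
open import Data.Nat.Tactic.RingSolver using (solve-∀)
open import Data.Product using (_×_; _,_)
open import Data.Sum using (inj₁; inj₂; [_,_])
open import Data.Unit using (tt)
open import Function using (_∘_; id; Equivalence)
open import Relation.Binary.Definitions using (tri<; tri≈; tri>)
open import Relation.Binary.PropositionalEquality as ≡ using (_≡_; _≢_; _≗_; cong-app)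
open import Relation.Nullary using (Dec; yes; no)
open import Defs

punchInℕ : ℕ → ℕ → ℕ
punchInℕ zero    k       = suc k
punchInℕ (suc j) zero    = zero
punchInℕ (suc j) (suc k) = suc (punchInℕ j k)

punchOutℕ : ℕ → ℕ → ℕ
punchOutℕ zero    k       = pred k
punchOutℕ (suc j) zero    = zero
punchOutℕ (suc j) (suc k) = suc (punchOutℕ j k)

punchInℕ-< : ∀ {n} j k → k < n → punchInℕ j k < suc n
punchInℕ-< zero    k       k<n       = s<s k<n
punchInℕ-< (suc j) zero    _         = z<s
punchInℕ-< (suc j) (suc k) (s<s k<n) = s<s (punchInℕ-< j k k<n)

punchInℕ-below : ∀ j k → k < j → punchInℕ j k ≡ k
punchInℕ-below (suc j) zero    _         = ≡.refl
punchInℕ-below (suc j) (suc k) (s<s k<j) = ≡.cong suc (punchInℕ-below j k k<j)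

punchInℕ-above : ∀ j k → j ≤ k → punchInℕ j k ≡ suc k
punchInℕ-above zero    k       _         = ≡.refl
punchInℕ-above (suc j) (suc k) (s≤s j≤k) = ≡.cong suc (punchInℕ-above j k j≤k)

punchInℕ-punchInℕ : ∀ j h k → j ≤ h → punchInℕ (suc h) (punchInℕ j k) ≡ punchInℕ j (punchInℕ h k)
punchInℕ-punchInℕ zero    h       k       _         = ≡.refl
punchInℕ-punchInℕ (suc j) (suc h) zero    _         = ≡.refl
punchInℕ-punchInℕ (suc j) (suc h) (suc k) (s≤s j≤h) = ≡.cong suc (punchInℕ-punchInℕ j h k j≤h)

punchInℕ-punchOutℕ : ∀ j k → k ≢ j → punchInℕ j (punchOutℕ j k) ≡ k
punchInℕ-punchOutℕ zero    zero    k≢j = ⊥-elim (k≢j ≡.refl)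
punchInℕ-punchOutℕ zero    (suc k) _   = ≡.refl
punchInℕ-punchOutℕ (suc j) zero    _   = ≡.refl
punchInℕ-punchOutℕ (suc j) (suc k) k≢j = ≡.cong suc (punchInℕ-punchOutℕ j k (λ k≡j → k≢j (≡.cong suc k≡j)))

punchOutℕ-punchInℕ : ∀ j k → punchOutℕ j (punchInℕ j k) ≡ k
punchOutℕ-punchInℕ zero    k       = ≡.refl
punchOutℕ-punchInℕ (suc j) zero    = ≡.refl
punchOutℕ-punchInℕ (suc j) (suc k) = ≡.cong suc (punchOutℕ-punchInℕ j k)

punchInℕ≢ : ∀ j k → punchInℕ j k ≢ j
punchInℕ≢ zero    k       ()
punchInℕ≢ (suc j) zero    ()
punchInℕ≢ (suc j) (suc k) eq = punchInℕ≢ j k (ℕₚ.suc-injective eq)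

punchOutℕ-< : ∀ {n} j k → j < suc n → k < suc n → k ≢ j → punchOutℕ j k < n
punchOutℕ-<         zero    zero    _         _         k≢j = ⊥-elim (k≢j ≡.refl)
punchOutℕ-<         zero    (suc k) _         (s<s k<n) _   = k<n
punchOutℕ-< {zero}  (suc j) k       (s<s ())  _         _
punchOutℕ-< {suc n} (suc j) zero    _         _         _   = z<s
punchOutℕ-< {suc n} (suc j) (suc k) (s<s j<n) (s<s k<n) k≢j =
  s<s (punchOutℕ-< j k j<n k<n (λ k≡j → k≢j (≡.cong suc k≡j)))

<ᵇ-suc : ∀ m n → (m <ᵇ suc n) ≡ not (n <ᵇ m)
<ᵇ-suc zero    n       = ≡.refl
<ᵇ-suc (suc m) zero    = ≡.refl
<ᵇ-suc (suc m) (suc n) = <ᵇ-suc m n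

infixl 6 _[_]≔_

_[_]≔_ : ∀ {a} {A : Set a} → (ℕ → A) → ℕ → A → ℕ → A
(f [ i ]≔ x) j with j ℕ.≟ i
... | yes _ = x
... | no  _ = f j

module _ {a} {A : Set a} where

  []≔-same : ∀ (f : ℕ → A) i x → (f [ i ]≔ x) i ≡ x
  []≔-same f i x with i ℕ.≟ i
  ... | yes _   = ≡.refl
  ... | no  i≢i = ⊥-elim (i≢i ≡.refl)

  []≔-other : ∀ (f : ℕ → A) i x {j} → j ≢ i → (f [ i ]≔ x) j ≡ f j
  []≔-other f i x {j} j≢i with j ℕ.≟ i
  ... | yes j≡i = ⊥-elim (j≢i j≡i)
  ... | no  _   = ≡.refl

  []≔-self : ∀ (f : ℕ → A) i → f [ i ]≔ f i ≗ f
  []≔-self f i j with j ℕ.≟ i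
  ... | yes ≡.refl = ≡.refl
  ... | no  _      = ≡.refl

  []≔-comm : ∀ (f : ℕ → A) {i j} x y → i ≢ j → f [ j ]≔ y [ i ]≔ x ≗ f [ i ]≔ x [ j ]≔ y
  []≔-comm f {i} {j} x y i≢j l with l ℕ.≟ i | l ℕ.≟ j
  ... | yes ≡.refl | yes ≡.refl = ⊥-elim (i≢j ≡.refl)
  ... | yes ≡.refl | no  _      = ≡.sym ([]≔-same f i x)
  ... | no  _      | yes ≡.refl = []≔-same f j y
  ... | no  l≢i    | no  l≢j    = ≡.trans ([]≔-other f j y l≢j) (≡.sym ([]≔-other f i x l≢i))

toℕ-punchIn : ∀ {n} (j : Fin (suc n)) (k : Fin n) → toℕ (punchIn j k) ≡ punchInℕ (toℕ j) (toℕ k)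
toℕ-punchIn fzero    k        = ≡.refl
toℕ-punchIn (fsuc j) fzero    = ≡.refl
toℕ-punchIn (fsuc j) (fsuc k) = ≡.cong suc (toℕ-punchIn j k)

module Determinant {c ℓ : Level} (R : CommutativeRing c ℓ) where

  open CommutativeRing R hiding (zero)
  open import Algebra.Properties.Ring ring
    using (-0#≈0#; -‿involutive; -‿+-comm; +-inverseʳ-unique; -‿distribʳ-*; x+x≈x⇒x≈0)
  open import Algebra.Properties.CommutativeSemigroup +-commutativeSemigroup
    using (interchange)
  open import Algebra.Properties.CommutativeSemigroup *-commutativeSemigroup
    using (x∙yz≈y∙xz)
  open import Relation.Binary.Reasoning.Setoid setoid

  ∑ : ℕ → (ℕ → Carrier) → Carrier
  ∑ zero    f = 0#
  ∑ (suc n) f = f 0 + ∑ n (f ∘ suc)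

  ∑-cong : ∀ n {f g : ℕ → Carrier} → (∀ i → i < n → f i ≈ g i) → ∑ n f ≈ ∑ n g
  ∑-cong zero    f≈g = refl
  ∑-cong (suc n) f≈g = +-cong (f≈g 0 z<s) (∑-cong n λ i i<n → f≈g (suc i) (s<s i<n))

  ∑-zero : ∀ n {f : ℕ → Carrier} → (∀ i → i < n → f i ≈ 0#) → ∑ n f ≈ 0#
  ∑-zero n f≈0 = trans (∑-cong n f≈0) (lemma n)
    where
      lemma : ∀ n → ∑ n (λ _ → 0#) ≈ 0#
      lemma zero    = refl
      lemma (suc n) = trans (+-identityˡ _) (lemma n)

  ∑-distrib-+ : ∀ n (f g : ℕ → Carrier) → ∑ n (λ i → f i + g i) ≈ ∑ n f + ∑ n g
  ∑-distrib-+ zero    f g = sym (+-identityˡ 0#)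
  ∑-distrib-+ (suc n) f g = trans (+-congˡ (∑-distrib-+ n _ _)) (interchange (f 0) (g 0) _ _)

  ∑-*ˡ : ∀ n a (f : ℕ → Carrier) → ∑ n (λ i → a * f i) ≈ a * ∑ n f
  ∑-*ˡ zero    a f = sym (zeroʳ a)
  ∑-*ˡ (suc n) a f = trans (+-congˡ (∑-*ˡ n a _)) (sym (distribˡ a _ _))

  ∑-neg : ∀ n (f : ℕ → Carrier) → ∑ n (λ i → - f i) ≈ - ∑ n f
  ∑-neg zero    f = sym -0#≈0#
  ∑-neg (suc n) f = trans (+-congˡ (∑-neg n _)) (-‿+-comm _ _)

  ∑-comm : ∀ n m (f : ℕ → ℕ → Carrier) → ∑ n (λ i → ∑ m (f i)) ≈ ∑ m (λ j → ∑ n (λ i → f i j))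
  ∑-comm zero    m f = sym (∑-zero m λ _ _ → refl)
  ∑-comm (suc n) m f = trans (+-congˡ (∑-comm n m (f ∘ suc))) (sym (∑-distrib-+ m (f 0) _))

  ∑-last : ∀ n (f : ℕ → Carrier) → ∑ (suc n) f ≈ ∑ n f + f n
  ∑-last zero    f = +-comm (f 0) 0#
  ∑-last (suc n) f = trans (+-congˡ (∑-last n (f ∘ suc))) (sym (+-assoc _ _ _))

  signed : ℕ → Carrier → Carrier
  signed zero    x = x
  signed (suc k) x = - signed k x

  signed-cong : ∀ k {x y} → x ≈ y → signed k x ≈ signed k y
  signed-cong zero    x≈y = x≈y
  signed-cong (suc k) x≈y = -‿cong (signed-cong k x≈y)

  signed-+ : ∀ k x y → signed k (x + y) ≈ signed k x + signed k y
  signed-+ zero    x y = refl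
  signed-+ (suc k) x y = trans (-‿cong (signed-+ k x y)) (sym (-‿+-comm _ _))

  signed-* : ∀ k x y → signed k (x * y) ≈ x * signed k y
  signed-* zero    x y = refl
  signed-* (suc k) x y = trans (-‿cong (signed-* k x y)) (-‿distribʳ-* _ _)

  signed-0# : ∀ k → signed k 0# ≈ 0#
  signed-0# zero    = refl
  signed-0# (suc k) = trans (-‿cong (signed-0# k)) -0#≈0#

  signed-signed : ∀ j k x → signed j (signed k x) ≡ signed (j +ℕ k) x
  signed-signed zero    k x = ≡.refl
  signed-signed (suc j) k x = ≡.cong -_ (signed-signed j k x)

  signed-∑ : ∀ j n (f : ℕ → Carrier) → signed j (∑ n f) ≈ ∑ n (λ i → signed j (f i))
  signed-∑ j zero    f = signed-0# j
  signed-∑ j (suc n) f = trans (signed-+ j _ _) (+-congˡ (signed-∑ j n _))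

  -- Matrices are indexed by ℕ; an n × n matrix is determined by its entries below n.
  Row : Set c
  Row = ℕ → Carrier

  Mat : Set c
  Mat = ℕ → Row

  infix 4 _≈ᵣ[_]_ _≈[_]_

  _≈ᵣ[_]_ : Row → ℕ → Row → Set ℓ
  u ≈ᵣ[ n ] v = ∀ k → k < n → u k ≈ v k

  _≈[_]_ : Mat → ℕ → Mat → Set ℓ
  M ≈[ n ] N = ∀ r → r < n → M r ≈ᵣ[ n ] N r

  ≡⇒≈ᵣ : ∀ {n} {u v : Row} → u ≡ v → u ≈ᵣ[ n ] v
  ≡⇒≈ᵣ u≡v k _ = reflexive (cong-app u≡v k)

  minor : ℕ → Mat → Mat
  minor j M r k = M (suc r) (punchInℕ j k)

  det : ℕ → Mat → Carrier
  det zero    M = 1#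
  det (suc n) M = ∑ (suc n) λ j → signed j (M 0 j * det n (minor j M))

  minor-cong : ∀ {n M N} j → j < suc n → M ≈[ suc n ] N → minor j M ≈[ n ] minor j N
  minor-cong j j<n M≈N r r<n k k<n = M≈N (suc r) (s<s r<n) (punchInℕ j k) (punchInℕ-< j k k<n)

  det-cong : ∀ n {M N} → M ≈[ n ] N → det n M ≈ det n N
  det-cong zero    M≈N = refl
  det-cong (suc n) M≈N = ∑-cong (suc n) λ j j<n →
    signed-cong j (*-cong (M≈N 0 z<s j j<n) (det-cong n (minor-cong j j<n M≈N)))

  AgreeOffRow : ℕ → ℕ → Mat → Mat → Set ℓ
  AgreeOffRow n i M N = ∀ r → r < n → r ≢ i → M r ≈ᵣ[ n ] N r

  record IsMultilinear (n : ℕ) (f : Mat → Carrier) : Set (c ⊔ ℓ) where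
    field
      cong   : ∀ {M N} → M ≈[ n ] N → f M ≈ f N
      linear : ∀ {i} → i < n → ∀ a M N P → AgreeOffRow n i M N → AgreeOffRow n i M P →
               M i ≈ᵣ[ n ] (λ k → a * N i k + P i k) → f M ≈ a * f N + f P

  Alternating : ℕ → (Mat → Carrier) → Set (c ⊔ ℓ)
  Alternating n f = ∀ {i j} M → i < j → j < n → M i ≈ᵣ[ n ] M j → f M ≈ 0#

  ∑-linear : ∀ n a (f g h : ℕ → Carrier) → (∀ j → j < n → f j ≈ a * g j + h j) →
             ∑ n f ≈ a * ∑ n g + ∑ n h
  ∑-linear n a f g h f≈ag+h =
    trans (∑-cong n f≈ag+h) (trans (∑-distrib-+ n _ _) (+-congʳ (∑-*ˡ n a g)))

  signed-linear : ∀ j a x y z → x ≈ a * y + z → signed j x ≈ a * signed j y + signed j z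
  signed-linear j a x y z x≈ay+z =
    trans (signed-cong j x≈ay+z) (trans (signed-+ j _ _) (+-congʳ (signed-* j a _)))

  minor-agreeOffRow₀ : ∀ {n M N} j → AgreeOffRow (suc n) 0 M N → minor j M ≈[ n ] minor j N
  minor-agreeOffRow₀ j M≈N r r<n k k<n = M≈N (suc r) (s<s r<n) (λ ()) (punchInℕ j k) (punchInℕ-< j k k<n)

  minor-agreeOffRow : ∀ {n i M N} j → AgreeOffRow (suc n) (suc i) M N → AgreeOffRow n i (minor j M) (minor j N)
  minor-agreeOffRow j M≈N r r<n r≢i k k<n =
    M≈N (suc r) (s<s r<n) (r≢i ∘ ℕₚ.suc-injective) (punchInℕ j k) (punchInℕ-< j k k<n)

  det-linear : ∀ n {i} → i < n → ∀ a M N P → AgreeOffRow n i M N → AgreeOffRow n i M P →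
               M i ≈ᵣ[ n ] (λ k → a * N i k + P i k) → det n M ≈ a * det n N + det n P
  det-linear (suc n) {zero} _ a M N P M≈N M≈P row =
    ∑-linear (suc n) a _ _ _ λ j j<n → signed-linear j a _ _ _ (begin
      M 0 j * det n (minor j M)
        ≈⟨ *-cong (row j j<n) (det-cong n (minor-agreeOffRow₀ j M≈N)) ⟩
      (a * N 0 j + P 0 j) * det n (minor j N)
        ≈⟨ distribʳ _ _ _ ⟩
      a * N 0 j * det n (minor j N) + P 0 j * det n (minor j N)
        ≈⟨ +-cong (*-assoc _ _ _) (*-congˡ (det-cong n (λ r r<n k k<n →
             trans (sym (minor-agreeOffRow₀ j M≈N r r<n k k<n)) (minor-agreeOffRow₀ j M≈P r r<n k k<n)))) ⟩
      a * (N 0 j * det n (minor j N)) + P 0 j * det n (minor j P) ∎)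
  det-linear (suc n) {suc i} (s<s i<n) a M N P M≈N M≈P row =
    ∑-linear (suc n) a _ _ _ λ j j<n → signed-linear j a _ _ _ (begin
      M 0 j * det n (minor j M)
        ≈⟨ *-congˡ (det-linear n i<n a (minor j M) (minor j N) (minor j P)
             (minor-agreeOffRow j M≈N) (minor-agreeOffRow j M≈P)
             (λ k k<n → row (punchInℕ j k) (punchInℕ-< j k k<n))) ⟩
      M 0 j * (a * det n (minor j N) + det n (minor j P))
        ≈⟨ distribˡ _ _ _ ⟩
      M 0 j * (a * det n (minor j N)) + M 0 j * det n (minor j P)
        ≈⟨ +-cong (trans (x∙yz≈y∙xz _ _ _) (*-congˡ (*-congʳ (M≈N 0 z<s (λ ()) j j<n))))
                  (*-congʳ (M≈P 0 z<s (λ ()) j j<n)) ⟩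
      a * (N 0 j * det n (minor j N)) + P 0 j * det n (minor j P) ∎)

  signed-swap : ∀ j k a b x → signed j (a * signed k (b * x)) ≈ signed k (b * signed j (a * x))
  signed-swap j k a b x = begin
    signed j (a * signed k (b * x))  ≈⟨ signed-cong j (signed-* k a _) ⟨
    signed j (signed k (a * (b * x))) ≡⟨ signed-signed j k _ ⟩
    signed (j +ℕ k) (a * (b * x))    ≡⟨ ≡.cong (λ l → signed l (a * (b * x))) (ℕₚ.+-comm j k) ⟩
    signed (k +ℕ j) (a * (b * x))    ≈⟨ signed-cong (k +ℕ j) (x∙yz≈y∙xz a b x) ⟩
    signed (k +ℕ j) (b * (a * x))    ≡⟨ signed-signed k j _ ⟨
    signed k (signed j (b * (a * x))) ≈⟨ signed-cong k (signed-* j b _) ⟩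
    signed k (b * signed j (a * x))  ∎

  when : Bool → Carrier → Carrier
  when b x = if b then x else 0#

  when-split : ∀ b x → x ≈ when b x + when (not b) x
  when-split true  x = sym (+-identityʳ x)
  when-split false x = sym (+-identityˡ x)

  -- Both sides sum F over the pairs j ≤ k < N.
  ∑-triangle : ∀ N (F : ℕ → ℕ → Carrier) →
    ∑ (suc N) (λ j → ∑ N (λ k → when (k <ᵇ j) (F k (pred j)))) ≈
    ∑ (suc N) (λ j → ∑ N (λ k → when (not (k <ᵇ j)) (F j k)))
  ∑-triangle N F = begin
    ∑ (suc N) (λ j → ∑ N (λ k → when (k <ᵇ j) (F k (pred j))))
      ≈⟨ trans (+-congʳ (∑-zero N λ _ _ → refl)) (+-identityˡ _) ⟩
    ∑ N (λ j → ∑ N (λ k → when (k <ᵇ suc j) (F k j)))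
      ≈⟨ ∑-comm N N _ ⟩
    ∑ N (λ k → ∑ N (λ j → when (k <ᵇ suc j) (F k j)))
      ≈⟨ ∑-cong N (λ k _ → ∑-cong N λ j _ → reflexive (≡.cong (λ b → when b (F k j)) (<ᵇ-suc k j))) ⟩
    ∑ N (λ j → ∑ N (λ k → when (not (k <ᵇ j)) (F j k)))
      ≈⟨ trans (+-congˡ (∑-zero N λ k k<N → reflexive (≡.cong (λ b → when (not b) (F N k)) (<ᵇ≡true k<N))))
               (+-identityʳ _) ⟨
    ∑ N (λ j → ∑ N (λ k → when (not (k <ᵇ j)) (F j k))) + ∑ N (λ k → when (not (k <ᵇ N)) (F N k))
      ≈⟨ ∑-last N _ ⟨
    ∑ (suc N) (λ j → ∑ N (λ k → when (not (k <ᵇ j)) (F j k))) ∎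
    where
      <ᵇ≡true : ∀ {k n} → k < n → (k <ᵇ n) ≡ true
      <ᵇ≡true k<n = Equivalence.to T-≡ (ℕₚ.<⇒<ᵇ k<n)

  module EqualFirstRows (m : ℕ) (M : Mat) (rows≈ : M 0 ≈ᵣ[ suc (suc m) ] M 1) where

    -- the (j , k) term of the expansion of det M along its first two rows
    term : ℕ → ℕ → Carrier
    term j k = signed j (M 0 j * signed k (M 1 (punchInℕ j k) * det m (minor k (minor j M))))

    term-antisym : ∀ j k → j < suc m → k ≤ j → term (suc j) k ≈ - term k j
    term-antisym j k j<m k≤j = -‿cong (begin
      signed j (a * signed k (M 1 (punchInℕ (suc j) k) * det m (minor k (minor (suc j) M))))
        ≈⟨ signed-cong j (*-congˡ (signed-cong k (*-cong M₁k≈b minors≈))) ⟩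
      signed j (a * signed k (b * det m (minor j (minor k M))))
        ≈⟨ signed-swap j k a b _ ⟩
      signed k (b * signed j (a * det m (minor j (minor k M))))
        ≈⟨ signed-cong k (*-congˡ (signed-cong j (*-congʳ M₁j≈a))) ⟨
      term k j ∎)
      where
        a = M 0 (suc j)
        b = M 0 k
        M₁k≈b : M 1 (punchInℕ (suc j) k) ≈ b
        M₁k≈b = trans (reflexive (≡.cong (M 1) (punchInℕ-below (suc j) k (s≤s k≤j))))
                      (sym (rows≈ k (ℕₚ.m<n⇒m<1+n (ℕₚ.≤-<-trans k≤j j<m))))
        M₁j≈a : M 1 (punchInℕ k j) ≈ a
        M₁j≈a = trans (reflexive (≡.cong (M 1) (punchInℕ-above k j k≤j))) (sym (rows≈ (suc j) (s<s j<m)))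
        minors≈ : det m (minor k (minor (suc j) M)) ≈ det m (minor j (minor k M))
        minors≈ = det-cong m λ r _ x _ → reflexive (≡.cong (M (suc (suc r))) (punchInℕ-punchInℕ k j x k≤j))

    lower-antisym : ∀ j k → j < suc (suc m) → when (k <ᵇ j) (term j k) ≈ - when (k <ᵇ j) (term k (pred j))
    lower-antisym zero    k _ = sym -0#≈0#
    lower-antisym (suc j) k (s<s j<m) with k <ᵇ suc j in k<j
    ... | true  = term-antisym j k j<m (ℕₚ.≤-pred (ℕₚ.<ᵇ⇒< k (suc j) (Equivalence.from T-≡ k<j)))
    ... | false = sym -0#≈0#

    Upper : Carrier
    Upper = ∑ (suc (suc m)) (λ j → ∑ (suc m) (λ k → when (not (k <ᵇ j)) (term j k)))

    Lower : ℕ → Carrier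
    Lower j = ∑ (suc m) (λ k → when (k <ᵇ j) (term k (pred j)))

    det≈∑∑term : det (suc (suc m)) M ≈ ∑ (suc (suc m)) (λ j → ∑ (suc m) (term j))
    det≈∑∑term = ∑-cong (suc (suc m)) {g = λ j → ∑ (suc m) (term j)} λ j _ →
      trans (signed-cong j (sym (∑-*ˡ (suc m) (M 0 j) (expansion j)))) (signed-∑ j (suc m) (λ k → M 0 j * expansion j k))
      where
        expansion : ℕ → ℕ → Carrier
        expansion j k = signed k (M 1 (punchInℕ j k) * det m (minor k (minor j M)))

    ∑term≈-Lower+Upper : ∀ j → j < suc (suc m) →
      ∑ (suc m) (term j) ≈ - Lower j + ∑ (suc m) (λ k → when (not (k <ᵇ j)) (term j k))
    ∑term≈-Lower+Upper j j<m = begin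
      ∑ (suc m) (term j)
        ≈⟨ ∑-cong (suc m) {g = λ k → when (k <ᵇ j) (term j k) + when (not (k <ᵇ j)) (term j k)}
             (λ k _ → when-split (k <ᵇ j) (term j k)) ⟩
      ∑ (suc m) (λ k → when (k <ᵇ j) (term j k) + when (not (k <ᵇ j)) (term j k))
        ≈⟨ ∑-distrib-+ (suc m) (λ k → when (k <ᵇ j) (term j k)) (λ k → when (not (k <ᵇ j)) (term j k)) ⟩
      ∑ (suc m) (λ k → when (k <ᵇ j) (term j k)) + ∑ (suc m) (λ k → when (not (k <ᵇ j)) (term j k))
        ≈⟨ +-congʳ (trans (∑-cong (suc m) λ k _ → lower-antisym j k j<m)
                          (∑-neg (suc m) λ k → when (k <ᵇ j) (term k (pred j)))) ⟩
      - Lower j + ∑ (suc m) (λ k → when (not (k <ᵇ j)) (term j k)) ∎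

    det≈0 : det (suc (suc m)) M ≈ 0#
    det≈0 = begin
      det (suc (suc m)) M
        ≈⟨ det≈∑∑term ⟩
      ∑ (suc (suc m)) (λ j → ∑ (suc m) (term j))
        ≈⟨ ∑-cong (suc (suc m)) {g = λ j → - Lower j + ∑ (suc m) (λ k → when (not (k <ᵇ j)) (term j k))}
             ∑term≈-Lower+Upper ⟩
      ∑ (suc (suc m)) (λ j → - Lower j + ∑ (suc m) (λ k → when (not (k <ᵇ j)) (term j k)))
        ≈⟨ ∑-distrib-+ (suc (suc m)) (λ j → - Lower j) (λ j → ∑ (suc m) (λ k → when (not (k <ᵇ j)) (term j k))) ⟩
      ∑ (suc (suc m)) (λ j → - Lower j) + Upper
        ≈⟨ +-congʳ (trans (∑-neg (suc (suc m)) Lower) (-‿cong (∑-triangle (suc m) term))) ⟩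
      - Upper + Upper
        ≈⟨ -‿inverseˡ Upper ⟩
      0# ∎

  det-equalAdjacentRows : ∀ n {i} M → suc i < n → M i ≈ᵣ[ n ] M (suc i) → det n M ≈ 0#
  det-equalAdjacentRows (suc (suc m)) {zero}  M _ rows≈ = EqualFirstRows.det≈0 m M rows≈
  det-equalAdjacentRows (suc n)       {suc i} M (s<s i<n) rows≈ =
    ∑-zero (suc n) {λ j → signed j (M 0 j * det n (minor j M))} λ j j<n →
    trans (signed-cong j (trans (*-congˡ (det-equalAdjacentRows n (minor j M) i<n
            λ k k<n → rows≈ (punchInℕ j k) (punchInℕ-< j k k<n))) (zeroʳ _)))
          (signed-0# j)

  ≗⇒≈ : ∀ {n} {M N : Mat} → M ≗ N → M ≈[ n ] N
  ≗⇒≈ M≗N r _ = ≡⇒≈ᵣ (M≗N r)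

  swapRows : ℕ → ℕ → Mat → Mat
  swapRows i j M = M [ j ]≔ M i [ i ]≔ M j

  mixRows : ℕ → Mat → Mat → Mat
  mixRows t N M r with r ℕₚ.≤? t
  ... | yes _ = N r
  ... | no  _ = M r

  mixRows-≤ : ∀ {t r} N M → r ≤ t → mixRows t N M r ≡ N r
  mixRows-≤ {t} {r} N M r≤t with r ℕₚ.≤? t
  ... | yes _   = ≡.refl
  ... | no  r≰t = ⊥-elim (r≰t r≤t)

  mixRows-> : ∀ {t r} N M → t < r → mixRows t N M r ≡ M r
  mixRows-> {t} {r} N M t<r with r ℕₚ.≤? t
  ... | yes r≤t = ⊥-elim (ℕₚ.<⇒≱ t<r r≤t)
  ... | no  _   = ≡.refl

  module Multilinear {n f} (f-multilinear : IsMultilinear n f) where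
    open IsMultilinear f-multilinear

    linear-update : ∀ {i} → i < n → ∀ a M u v w → u ≈ᵣ[ n ] (λ k → a * v k + w k) →
                    f (M [ i ]≔ u) ≈ a * f (M [ i ]≔ v) + f (M [ i ]≔ w)
    linear-update {i} i<n a M u v w u≈av+w = linear i<n a _ _ _ (agree v) (agree w) λ k k<n → begin
      (M [ i ]≔ u) i k              ≡⟨ cong-app ([]≔-same M i u) k ⟩
      u k                           ≈⟨ u≈av+w k k<n ⟩
      a * v k + w k                 ≡⟨ ≡.cong₂ (λ x y → a * x + y) (cong-app ([]≔-same M i v) k)
                                                                    (cong-app ([]≔-same M i w) k) ⟨
      a * (M [ i ]≔ v) i k + (M [ i ]≔ w) i k ∎
      where
        agree : ∀ x → AgreeOffRow n i (M [ i ]≔ u) (M [ i ]≔ x)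
        agree x r _ r≢i = ≡⇒≈ᵣ (≡.trans ([]≔-other M i u r≢i) (≡.sym ([]≔-other M i x r≢i)))

    additive-update : ∀ {i} → i < n → ∀ M (u v : Row) →
                      f (M [ i ]≔ (λ k → u k + v k)) ≈ f (M [ i ]≔ u) + f (M [ i ]≔ v)
    additive-update i<n M u v =
      trans (linear-update i<n 1# M _ u v λ k _ → +-congʳ (sym (*-identityˡ (u k))))
            (+-congʳ (*-identityˡ _))

    zero-row : ∀ {i} → i < n → ∀ M → M i ≈ᵣ[ n ] (λ _ → 0#) → f M ≈ 0#
    zero-row {i} i<n M Mᵢ≈0 = x+x≈x⇒x≈0 (f M) (sym (begin
      f M                ≈⟨ linear i<n 1# M M M (λ _ _ _ _ _ → refl) (λ _ _ _ _ _ → refl) Mᵢ≈Mᵢ+Mᵢ ⟩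
      1# * f M + f M     ≈⟨ +-congʳ (*-identityˡ (f M)) ⟩
      f M + f M          ∎))
      where
        Mᵢ≈Mᵢ+Mᵢ : M i ≈ᵣ[ n ] (λ k → 1# * M i k + M i k)
        Mᵢ≈Mᵢ+Mᵢ k k<n = begin
          M i k                 ≈⟨ Mᵢ≈0 k k<n ⟩
          0#                    ≈⟨ +-identityˡ 0# ⟨
          0# + 0#               ≈⟨ +-congʳ (*-identityˡ 0#) ⟨
          1# * 0# + 0#          ≈⟨ +-cong (*-congˡ (Mᵢ≈0 k k<n)) (Mᵢ≈0 k k<n) ⟨
          1# * M i k + M i k    ∎

    -- f (M [ j ]≔ v [ i ]≔ u) is biadditive in (u , v) and vanishes on the diagonal, hence antisymmetric.
    swap-antisym : ∀ {i j} → i < n → j < n → i ≢ j → (∀ M → M i ≈ᵣ[ n ] M j → f M ≈ 0#) →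
                   ∀ M → f (swapRows i j M) ≈ - f M
    swap-antisym {i} {j} i<n j<n i≢j equal⇒0 M = +-inverseʳ-unique (f M) (f (swapRows i j M)) (begin
      f M + f (swapRows i j M)                ≈⟨ +-congʳ (cong (≗⇒≈ λ r → ≡.sym (g-self r))) ⟩
      g (M i) (M j) + g (M j) (M i)           ≈⟨ +-cong (sym (trans (+-congʳ (diag (M i))) (+-identityˡ _)))
                                                         (sym (trans (+-congˡ (diag (M j))) (+-identityʳ _))) ⟩
      (g u u + g u v) + (g v u + g v v)       ≈⟨ +-cong (sym (additiveʳ u u v)) (sym (additiveʳ v u v)) ⟩
      g u w + g v w                           ≈⟨ sym (additiveˡ u v w) ⟩
      g w w                                   ≈⟨ diag w ⟩
      0#                                      ∎)
      where
        u = M i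
        v = M j
        w : Row
        w k = u k + v k
        g : Row → Row → Carrier
        g x y = f (M [ j ]≔ y [ i ]≔ x)
        g-self : M [ j ]≔ M j [ i ]≔ M i ≗ M
        g-self r = ≡.trans (≡.cong (λ x → (M [ j ]≔ M j [ i ]≔ x) r) (≡.sym ([]≔-other M j (M j) i≢j)))
                           (≡.trans ([]≔-self (M [ j ]≔ M j) i r) ([]≔-self M j r))
        additiveˡ : ∀ x x′ y → g (λ k → x k + x′ k) y ≈ g x y + g x′ y
        additiveˡ x x′ y = additive-update i<n (M [ j ]≔ y) x x′
        additiveʳ : ∀ x y y′ → g x (λ k → y k + y′ k) ≈ g x y + g x y′
        additiveʳ x y y′ = trans (cong (≗⇒≈ ([]≔-comm M x _ i≢j)))
          (trans (additive-update j<n (M [ i ]≔ x) y y′)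
                 (+-cong (cong (≗⇒≈ (λ r → ≡.sym ([]≔-comm M x y i≢j r))))
                         (cong (≗⇒≈ (λ r → ≡.sym ([]≔-comm M x y′ i≢j r))))))
        diag : ∀ x → g x x ≈ 0#
        diag x = equal⇒0 (M [ j ]≔ x [ i ]≔ x) λ k _ →
          reflexive (cong-app (≡.trans ([]≔-same _ i x)
                                       (≡.sym (≡.trans ([]≔-other _ i x (i≢j ∘ ≡.sym)) ([]≔-same M j x)))) k)

    alternating : (∀ {i} M → suc i < n → M i ≈ᵣ[ n ] M (suc i) → f M ≈ 0#) → Alternating n f
    alternating adjacent⇒0 {i} {suc j} M i<1+j 1+j<n Mᵢ≈M₁₊ⱼ with ℕₚ.m<1+n⇒m<n∨m≡n i<1+j
    ... | inj₂ ≡.refl = adjacent⇒0 M 1+j<n Mᵢ≈M₁₊ⱼ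
    ... | inj₁ i<j    = begin
      f M          ≈⟨ -‿involutive (f M) ⟨
      - - f M      ≈⟨ -‿cong (swap-antisym j<n 1+j<n j≢1+j (λ N → adjacent⇒0 N 1+j<n) M) ⟨
      - f M′       ≈⟨ -‿cong (alternating adjacent⇒0 M′ i<j j<n M′ᵢ≈M′ⱼ) ⟩
      - 0#         ≈⟨ -0#≈0# ⟩
      0#           ∎
      where
        j<n = ℕₚ.<-trans (ℕₚ.n<1+n j) 1+j<n
        j≢1+j = ℕₚ.<⇒≢ (ℕₚ.n<1+n j)
        M′ = swapRows j (suc j) M
        M′ᵢ≈M′ⱼ : M′ i ≈ᵣ[ n ] M′ j
        M′ᵢ≈M′ⱼ k k<n = begin
          M′ i k       ≡⟨ cong-app (≡.trans ([]≔-other _ j _ (ℕₚ.<⇒≢ i<j))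
                                            ([]≔-other M (suc j) _ (ℕₚ.<⇒≢ i<1+j))) k ⟩
          M i k        ≈⟨ Mᵢ≈M₁₊ⱼ k k<n ⟩
          M (suc j) k  ≡⟨ cong-app ([]≔-same _ j _) k ⟨
          M′ j k       ∎

    add-row-multiple : ∀ {i j} → i < n → j < n → i ≢ j → Alternating n f →
      ∀ a M → f (M [ i ]≔ (λ k → a * M j k + M i k)) ≈ f M
    add-row-multiple {i} {j} i<n j<n i≢j f-alternating a M = begin
      f (M [ i ]≔ (λ k → a * M j k + M i k))    ≈⟨ linear-update i<n a M _ (M j) (M i) (λ _ _ → refl) ⟩
      a * f (M [ i ]≔ M j) + f (M [ i ]≔ M i)  ≈⟨ +-cong (*-congˡ equal-rows⇒0) (cong (≗⇒≈ ([]≔-self M i))) ⟩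
      a * 0# + f M                              ≈⟨ +-congʳ (zeroʳ a) ⟩
      0# + f M                                  ≈⟨ +-identityˡ (f M) ⟩
      f M                                       ∎
      where
        rowᵢ≈rowⱼ : (M [ i ]≔ M j) i ≈ᵣ[ n ] (M [ i ]≔ M j) j
        rowᵢ≈rowⱼ = ≡⇒≈ᵣ (≡.trans ([]≔-same M i (M j)) (≡.sym ([]≔-other M i (M j) (i≢j ∘ ≡.sym))))
        equal-rows⇒0 : f (M [ i ]≔ M j) ≈ 0#
        equal-rows⇒0 with ℕₚ.<-cmp i j
        ... | tri< i<j _ _ = f-alternating _ i<j j<n rowᵢ≈rowⱼ
        ... | tri≈ _ i≡j _ = ⊥-elim (i≢j i≡j)
        ... | tri> _ _ j<i = f-alternating _ j<i i<n (λ k k<n → sym (rowᵢ≈rowⱼ k k<n))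

    expand-update : ∀ {i} → i < n → ∀ K (cs : ℕ → Carrier) (vs : ℕ → Row) M u →
      u ≈ᵣ[ n ] (λ k → ∑ K (λ l → cs l * vs l k)) →
      f (M [ i ]≔ u) ≈ ∑ K (λ l → cs l * f (M [ i ]≔ vs l))
    expand-update {i} i<n zero    cs vs M u u≈∑ =
      zero-row i<n (M [ i ]≔ u) (λ k k<n → trans (reflexive (cong-app ([]≔-same M i u) k)) (u≈∑ k k<n))
    expand-update i<n (suc K) cs vs M u u≈∑ =
      trans (linear-update i<n (cs 0) M u (vs 0) rest u≈∑)
            (+-congˡ (expand-update i<n K (cs ∘ suc) (vs ∘ suc) M rest (λ _ _ → refl)))
      where
        rest : Row
        rest k = ∑ K (λ l → cs (suc l) * vs (suc l) k)

    module _ (f-alternating : Alternating n f) where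

      -- Replacing rows 1, 2, … one at a time, each step adds a multiple of row 0.
      add-multiples-of-row₀ : ∀ M N (d : ℕ → Carrier) → M 0 ≈ᵣ[ n ] N 0 →
        (∀ r → r < n → M (suc r) ≈ᵣ[ n ] (λ k → d (suc r) * N 0 k + N (suc r) k)) → f M ≈ f N
      add-multiples-of-row₀ M N d M₀≈N₀ M≈N+dN₀ = trans (cong M≈mix₀) (trans (chain n) (cong mixₙ≈N))
        where
          mix : ℕ → Mat
          mix t = mixRows t N M

          M≈mix₀ : M ≈[ n ] mix 0
          M≈mix₀ = λ where
            zero    _ → λ k k<n → trans (M₀≈N₀ k k<n) (reflexive (≡.sym (cong-app (mixRows-≤ {0} N M z≤n) k)))
            (suc r) _ → ≡⇒≈ᵣ (≡.sym (mixRows-> N M z<s))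

          mixₙ≈N : mix n ≈[ n ] N
          mixₙ≈N r r<n = ≡⇒≈ᵣ (mixRows-≤ N M (ℕₚ.<⇒≤ r<n))

          same-rows : ∀ t r → r ≢ suc t → mix t r ≡ mix (suc t) r
          same-rows t r r≢1+t with ℕₚ.≤-<-connex r t
          ... | inj₁ r≤t = ≡.trans (mixRows-≤ N M r≤t) (≡.sym (mixRows-≤ N M (ℕₚ.m≤n⇒m≤1+n r≤t)))
          ... | inj₂ t<r = ≡.trans (mixRows-> N M t<r) (≡.sym (mixRows-> N M (ℕₚ.≤∧≢⇒< t<r (r≢1+t ∘ ≡.sym))))

          step : ∀ t → f (mix t) ≈ f (mix (suc t))
          step t with suc t ℕₚ.<? n
          ... | no  1+t≮n = cong λ r r<n → ≡⇒≈ᵣ (same-rows t r λ r≡1+t → 1+t≮n (≡.subst (_< n) r≡1+t r<n))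
          ... | yes 1+t<n = trans (cong mix≈) (add-row-multiple 1+t<n (ℕₚ.<-≤-trans z<s (ℕₚ.<⇒≤ 1+t<n)) (λ ())
                                                                f-alternating (d (suc t)) (mix (suc t)))
            where
              mix≈ : mix t ≈[ n ] mix (suc t) [ suc t ]≔ (λ k → d (suc t) * mix (suc t) 0 k + mix (suc t) (suc t) k)
              mix≈ r _ with r ℕ.≟ suc t
              ... | no  r≢1+t = ≡⇒≈ᵣ (same-rows t r r≢1+t)
              ... | yes ≡.refl = λ k k<n → begin
                mix t (suc t) k                                   ≡⟨ cong-app (mixRows-> N M (ℕₚ.n<1+n t)) k ⟩
                M (suc t) k                                       ≈⟨ M≈N+dN₀ t (ℕₚ.<-trans (ℕₚ.n<1+n t) 1+t<n) k k<n ⟩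
                d (suc t) * N 0 k + N (suc t) k                   ≡⟨ ≡.cong₂ (λ x y → d (suc t) * x + y)
                                                                       (cong-app (mixRows-≤ {suc t} N M z≤n) k)
                                                                       (cong-app (mixRows-≤ N M ℕₚ.≤-refl) k) ⟨
                d (suc t) * mix (suc t) 0 k + mix (suc t) (suc t) k ∎

          chain : ∀ t → f (mix 0) ≈ f (mix t)
          chain zero    = refl
          chain (suc t) = trans (chain t) (step t)

  det-isMultilinear : ∀ n → IsMultilinear n (det n)
  det-isMultilinear n = record { cong = det-cong n ; linear = det-linear n }

  det-alternating : ∀ n → Alternating n (det n)
  det-alternating n = Multilinear.alternating (det-isMultilinear n) (det-equalAdjacentRows n)

  δ : Mat
  δ zero    zero    = 1#
  δ zero    (suc k) = 0#
  δ (suc r) zero    = 0#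
  δ (suc r) (suc k) = δ r k

  δ-diagonal : ∀ k → δ k k ≡ 1#
  δ-diagonal zero    = ≡.refl
  δ-diagonal (suc k) = δ-diagonal k

  δ-offDiagonal : ∀ {r k} → r ≢ k → δ r k ≡ 0#
  δ-offDiagonal {zero}  {zero}  r≢k = ⊥-elim (r≢k ≡.refl)
  δ-offDiagonal {zero}  {suc k} _   = ≡.refl
  δ-offDiagonal {suc r} {zero}  _   = ≡.refl
  δ-offDiagonal {suc r} {suc k} r≢k = δ-offDiagonal (r≢k ∘ ≡.cong suc)

  δ-sym : ∀ r k → δ r k ≡ δ k r
  δ-sym zero    zero    = ≡.refl
  δ-sym zero    (suc k) = ≡.refl
  δ-sym (suc r) zero    = ≡.refl
  δ-sym (suc r) (suc k) = δ-sym r k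

  ∑-δ : ∀ n (a : ℕ → Carrier) {k} → k < n → ∑ n (λ l → a l * δ l k) ≈ a k
  ∑-δ (suc n) a {zero}  _         =
    trans (+-cong (*-identityʳ (a 0)) (∑-zero n λ l _ → zeroʳ (a (suc l)))) (+-identityʳ _)
  ∑-δ (suc n) a {suc k} (s<s k<n) = trans (+-cong (zeroʳ (a 0)) (∑-δ n (a ∘ suc) k<n)) (+-identityˡ _)

  det-δ : ∀ n → det n δ ≈ 1#
  det-δ zero    = refl
  det-δ (suc n) = trans (+-cong (trans (*-identityˡ _) (det-δ n))
                                (∑-zero n λ j _ → trans (signed-cong (suc j) (zeroˡ _)) (signed-0# (suc j))))
                        (+-identityʳ 1#)

  insertZero : ℕ → Row → Row
  insertZero k w x with x ℕ.≟ k
  ... | yes _ = 0#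
  ... | no  _ = w (punchOutℕ k x)

  insertZero-cong : ∀ {n} k → k < suc n → ∀ {v w} → v ≈ᵣ[ n ] w → insertZero k v ≈ᵣ[ suc n ] insertZero k w
  insertZero-cong k k<n v≈w x x<n with x ℕ.≟ k
  ... | yes _   = refl
  ... | no  x≢k = v≈w (punchOutℕ k x) (punchOutℕ-< k x k<n x<n x≢k)

  insertZero-linear : ∀ {n} k → k < suc n → ∀ a {u v w} → u ≈ᵣ[ n ] (λ x → a * v x + w x) →
    insertZero k u ≈ᵣ[ suc n ] (λ x → a * insertZero k v x + insertZero k w x)
  insertZero-linear k k<n a u≈av+w x x<n with x ℕ.≟ k
  ... | yes _   = sym (trans (+-congʳ (zeroʳ a)) (+-identityˡ 0#))
  ... | no  x≢k = u≈av+w (punchOutℕ k x) (punchOutℕ-< k x k<n x<n x≢k)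

  bordered : ℕ → Mat → Mat
  bordered k N zero    = δ k
  bordered k N (suc r) = insertZero k (N r)

  module Bordered {m f} (f-multilinear : IsMultilinear (suc m) f) (f-alternating : Alternating (suc m) f)
                  {k} (k<m : k < suc m) where
    open IsMultilinear f-multilinear

    fₖ : Mat → Carrier
    fₖ N = f (bordered k N)

    isMultilinear : IsMultilinear m fₖ
    isMultilinear = record
      { cong   = λ M≈N → cong λ where
          zero    _         → λ _ _ → refl
          (suc r) (s<s r<m) → insertZero-cong k k<m (M≈N r r<m)
      ; linear = λ i<m a M N P M≈N M≈P row →
          linear (s<s i<m) a _ _ _ (agree M≈N) (agree M≈P) (insertZero-linear k k<m a row)
      }
      where
        agree : ∀ {i M N} → AgreeOffRow m i M N → AgreeOffRow (suc m) (suc i) (bordered k M) (bordered k N)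
        agree M≈N zero    _         _      = λ _ _ → refl
        agree M≈N (suc r) (s<s r<m) r≢i = insertZero-cong k k<m (M≈N r r<m (r≢i ∘ ≡.cong suc))

    alternating : Alternating m fₖ
    alternating M i<j j<m Mᵢ≈Mⱼ = f-alternating (bordered k M) (s<s i<j) (s<s j<m) (insertZero-cong k k<m Mᵢ≈Mⱼ)

    -- Subtracting A r k times the first row δ k clears column k below it.
    clear-column : ∀ A → f (A [ 0 ]≔ δ k) ≈ fₖ (minor k A)
    clear-column A = Multilinear.add-multiples-of-row₀ f-multilinear f-alternating
      (A [ 0 ]≔ δ k) (bordered k (minor k A)) (λ r → A r k) (λ _ _ → refl) row
      where
        row : ∀ r → r < suc m → A (suc r) ≈ᵣ[ suc m ] (λ x → A (suc r) k * δ k x + insertZero k (minor k A r) x)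
        row r _ x _ with x ℕ.≟ k
        ... | yes ≡.refl = sym (trans (+-identityʳ _) (trans (*-congˡ (reflexive (δ-diagonal x))) (*-identityʳ _)))
        ... | no  x≢k    = sym (begin
          A (suc r) k * δ k x + A (suc r) (punchInℕ k (punchOutℕ k x))
            ≈⟨ +-cong (trans (*-congˡ (reflexive (δ-offDiagonal (x≢k ∘ ≡.sym)))) (zeroʳ _))
                      (reflexive (≡.cong (A (suc r)) (punchInℕ-punchOutℕ k x x≢k))) ⟩
          0# + A (suc r) x
            ≈⟨ +-identityˡ _ ⟩
          A (suc r) x ∎)

  cycle : ℕ → Mat
  cycle k zero    = δ k
  cycle k (suc r) = δ (punchInℕ k r)

  bordered-δ : ∀ k r x → bordered k δ r x ≡ cycle k r x
  bordered-δ k zero    x = ≡.refl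
  bordered-δ k (suc r) x with x ℕ.≟ k
  ... | yes ≡.refl = ≡.sym (δ-offDiagonal (punchInℕ≢ x r))
  ... | no  x≢k with r ℕ.≟ punchOutℕ k x
  ...   | yes ≡.refl = ≡.trans (δ-diagonal r)
                         (≡.sym (≡.trans (≡.cong (λ y → δ y x) (punchInℕ-punchOutℕ k x x≢k)) (δ-diagonal x)))
  ...   | no  r≢x′   = ≡.trans (δ-offDiagonal r≢x′) (≡.sym (δ-offDiagonal λ k⊕r≡x →
                         r≢x′ (≡.trans (≡.sym (punchOutℕ-punchInℕ k r)) (≡.cong (punchOutℕ k) k⊕r≡x))))

  cycle-suc : ∀ k → cycle (suc k) ≗ swapRows 0 (suc k) (cycle k)
  cycle-suc k zero    = ≡.trans (≡.cong δ (≡.sym (punchInℕ-above k k ℕₚ.≤-refl)))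
                                (≡.sym ([]≔-same (cycle k [ suc k ]≔ δ k) 0 (cycle k (suc k))))
  cycle-suc k (suc r) = ≡.trans (lower-row r) (≡.sym ([]≔-other (cycle k [ suc k ]≔ δ k) 0 (cycle k (suc k)) {suc r} λ ()))
    where
      lower-row : ∀ r → δ (punchInℕ (suc k) r) ≡ (cycle k [ suc k ]≔ δ k) (suc r)
      lower-row r with ℕₚ.<-cmp r k
      ... | tri< r<k _ _    = ≡.trans (≡.cong δ (≡.trans (punchInℕ-below (suc k) r (ℕₚ.m<n⇒m<1+n r<k))
                                                         (≡.sym (punchInℕ-below k r r<k))))
                                      (≡.sym ([]≔-other (cycle k) (suc k) (δ k) (ℕₚ.<⇒≢ (s<s r<k))))
      ... | tri≈ _ ≡.refl _ = ≡.trans (≡.cong δ (punchInℕ-below (suc r) r (ℕₚ.n<1+n r)))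
                                      (≡.sym ([]≔-same (cycle r) (suc r) (δ r)))
      ... | tri> _ _ k<r    = ≡.trans (≡.cong δ (≡.trans (punchInℕ-above (suc k) r k<r)
                                                         (≡.sym (punchInℕ-above k r (ℕₚ.<⇒≤ k<r)))))
                                      (≡.sym ([]≔-other (cycle k) (suc k) (δ k) (ℕₚ.>⇒≢ (s<s k<r))))

  cycle-sign : ∀ {n f} → IsMultilinear n f → Alternating n f → ∀ {k} → k < n → f (cycle k) ≈ signed k (f δ)
  cycle-sign f-multilinear f-alternating {zero}  _     =
    IsMultilinear.cong f-multilinear λ where
      zero    _ → λ _ _ → refl
      (suc r) _ → λ _ _ → refl
  cycle-sign {n} {f} f-multilinear f-alternating {suc k} 1+k<n = begin
    f (cycle (suc k))                  ≈⟨ IsMultilinear.cong f-multilinear (≗⇒≈ (cycle-suc k)) ⟩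
    f (swapRows 0 (suc k) (cycle k))   ≈⟨ Multilinear.swap-antisym f-multilinear 0<n 1+k<n (λ ())
                                             (λ M → f-alternating M z<s 1+k<n) (cycle k) ⟩
    - f (cycle k)                      ≈⟨ -‿cong (cycle-sign f-multilinear f-alternating (ℕₚ.<-trans (ℕₚ.n<1+n k) 1+k<n)) ⟩
    signed (suc k) (f δ)               ∎
    where 0<n = ℕₚ.<-≤-trans z<s (ℕₚ.<⇒≤ 1+k<n)

  multilinear-alternating-unique : ∀ n {f} → IsMultilinear n f → Alternating n f → ∀ A → f A ≈ det n A * f δ
  multilinear-alternating-unique zero    f-multilinear _ A =
    trans (IsMultilinear.cong f-multilinear (λ _ ())) (sym (*-identityˡ _))
  multilinear-alternating-unique (suc m) {f} f-multilinear f-alternating A = begin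
    f A
      ≈⟨ IsMultilinear.cong f-multilinear (≗⇒≈ ([]≔-self A 0)) ⟨
    f (A [ 0 ]≔ A 0)
      ≈⟨ Multilinear.expand-update f-multilinear z<s (suc m) (A 0) δ A (A 0) (λ x x<n → sym (∑-δ (suc m) (A 0) x<n)) ⟩
    ∑ (suc m) (λ k → A 0 k * f (A [ 0 ]≔ δ k))
      ≈⟨ ∑-cong (suc m) {λ k → A 0 k * f (A [ 0 ]≔ δ k)} (λ k k<n → *-congˡ (column k k<n)) ⟩
    ∑ (suc m) (λ k → A 0 k * (det m (minor k A) * signed k (f δ)))
      ≈⟨ ∑-cong (suc m) (λ k _ → rearrange (A 0 k) (det m (minor k A)) k (f δ)) ⟩
    ∑ (suc m) (λ k → f δ * signed k (A 0 k * det m (minor k A)))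
      ≈⟨ ∑-*ˡ (suc m) (f δ) (λ k → signed k (A 0 k * det m (minor k A))) ⟩
    f δ * det (suc m) A
      ≈⟨ *-comm _ _ ⟩
    det (suc m) A * f δ ∎
    where
      column : ∀ k → k < suc m → f (A [ 0 ]≔ δ k) ≈ det m (minor k A) * signed k (f δ)
      column k k<n = begin
        f (A [ 0 ]≔ δ k)                        ≈⟨ clear-column A ⟩
        fₖ (minor k A)                          ≈⟨ multilinear-alternating-unique m isMultilinear alternating (minor k A) ⟩
        det m (minor k A) * f (bordered k δ)    ≈⟨ *-congˡ (IsMultilinear.cong f-multilinear λ r _ x _ →
                                                              reflexive (bordered-δ k r x)) ⟩
        det m (minor k A) * f (cycle k)         ≈⟨ *-congˡ (cycle-sign f-multilinear f-alternating k<n) ⟩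
        det m (minor k A) * signed k (f δ)      ∎
        where open Bordered f-multilinear f-alternating k<n
      rearrange : ∀ a d k x → a * (d * signed k x) ≈ x * signed k (a * d)
      rearrange a d k x = begin
        a * (d * signed k x)   ≈⟨ *-assoc a d _ ⟨
        (a * d) * signed k x   ≈⟨ signed-* k (a * d) x ⟨
        signed k (a * d * x)   ≈⟨ signed-cong k (*-comm _ _) ⟩
        signed k (x * (a * d)) ≈⟨ signed-* k x (a * d) ⟩
        x * signed k (a * d)   ∎

  mul : ℕ → Mat → Mat → Mat
  mul n A B r x = ∑ n (λ l → A r l * B l x)

  det-mul : ∀ n A B → det n (mul n A B) ≈ det n A * det n B
  det-mul n A B = trans (multilinear-alternating-unique n isMultilinear alternating A) (*-congˡ det-δB)
    where
      f : Mat → Carrier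
      f M = det n (mul n M B)

      mul-cong : ∀ {u v : Row} → u ≈ᵣ[ n ] v →
                 (λ x → ∑ n λ l → u l * B l x) ≈ᵣ[ n ] (λ x → ∑ n λ l → v l * B l x)
      mul-cong u≈v x _ = ∑-cong n λ l l<n → *-congʳ (u≈v l l<n)

      isMultilinear : IsMultilinear n f
      isMultilinear = record
        { cong   = λ M≈N → det-cong n λ r r<n → mul-cong (M≈N r r<n)
        ; linear = λ {i} i<n a M N P M≈N M≈P row → det-linear n i<n a _ _ _
            (λ r r<n r≢i → mul-cong (M≈N r r<n r≢i)) (λ r r<n r≢i → mul-cong (M≈P r r<n r≢i))
            λ x _ → ∑-linear n a _ _ _ λ l l<n →
              trans (*-congʳ (row l l<n)) (trans (distribʳ _ _ _) (+-congʳ (*-assoc _ _ _)))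
        }

      alternating : Alternating n f
      alternating M i<j j<n Mᵢ≈Mⱼ = det-alternating n (mul n M B) i<j j<n (mul-cong Mᵢ≈Mⱼ)

      det-δB : f δ ≈ det n B
      det-δB = det-cong n λ r r<n x _ →
        trans (∑-cong n λ l _ → trans (*-congʳ (reflexive (δ-sym r l))) (*-comm _ _)) (∑-δ n (λ l → B l x) r<n)

  -- detᶠ is Poly.det, read in an arbitrary commutative ring.
  ∑ᶠ : ∀ {n} → (Fin n → Carrier) → Carrier
  ∑ᶠ {zero}  f = 0#
  ∑ᶠ {suc n} f = f fzero + ∑ᶠ (f ∘ fsuc)

  detᶠ : ∀ n → (Fin n → Fin n → Carrier) → Carrier
  detᶠ zero    M = 1#
  detᶠ (suc n) M = ∑ᶠ λ j → signed (toℕ j) (M fzero j * detᶠ n (λ i k → M (fsuc i) (punchIn j k)))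

  ∑ᶠ≈∑ : ∀ n (f : Fin n → Carrier) (g : ℕ → Carrier) → (∀ j → f j ≈ g (toℕ j)) → ∑ᶠ f ≈ ∑ n g
  ∑ᶠ≈∑ zero    f g f≈g = refl
  ∑ᶠ≈∑ (suc n) f g f≈g = +-cong (f≈g fzero) (∑ᶠ≈∑ n (f ∘ fsuc) (g ∘ suc) (f≈g ∘ fsuc))

  detᶠ≈det : ∀ n (M : Fin n → Fin n → Carrier) (N : Mat) →
             (∀ i j → M i j ≈ N (toℕ i) (toℕ j)) → detᶠ n M ≈ det n N
  detᶠ≈det zero    M N M≈N = refl
  detᶠ≈det (suc n) M N M≈N = ∑ᶠ≈∑ (suc n) _ (λ j → signed j (N 0 j * det n (minor j N))) λ j →
    signed-cong (toℕ j) (*-cong (M≈N fzero j) (detᶠ≈det n _ (minor (toℕ j) N) λ i k →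
      trans (M≈N (fsuc i) (punchIn j k)) (reflexive (≡.cong (N (suc (toℕ i))) (toℕ-punchIn j k)))))

  toMat : ∀ {n} → (Fin n → Fin n → Carrier) → Mat
  toMat {n} M r x with r ℕₚ.<? n | x ℕₚ.<? n
  ... | yes r<n | yes x<n = M (fromℕ< r<n) (fromℕ< x<n)
  ... | _       | _       = 0#

  toMat-toℕ : ∀ {n} (M : Fin n → Fin n → Carrier) i j → M i j ≈ toMat M (toℕ i) (toℕ j)
  toMat-toℕ {n} M i j with toℕ i ℕₚ.<? n | toℕ j ℕₚ.<? n
  ... | yes i<n | yes j<n = reflexive (≡.cong₂ M (≡.sym (Finₚ.fromℕ<-toℕ i i<n)) (≡.sym (Finₚ.fromℕ<-toℕ j j<n)))
  ... | no  i≮n | _       = ⊥-elim (i≮n (Finₚ.toℕ<n i))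
  ... | yes _   | no  j≮n = ⊥-elim (j≮n (Finₚ.toℕ<n j))

  detᶠ≈det-toMat : ∀ n (M : Fin n → Fin n → Carrier) → detᶠ n M ≈ det n (toMat M)
  detᶠ≈det-toMat n M = detᶠ≈det n M (toMat M) (toMat-toℕ M)

  detᶠ-cong : ∀ n {M N : Fin n → Fin n → Carrier} → (∀ i j → M i j ≈ N i j) → detᶠ n M ≈ detᶠ n N
  detᶠ-cong n {M} {N} M≈N =
    trans (detᶠ≈det n M (toMat N) λ i j → trans (M≈N i j) (toMat-toℕ N i j)) (sym (detᶠ≈det-toMat n N))

  detᶠ-identity : ∀ n (M : Fin n → Fin n → Carrier) → (∀ i j → M i j ≈ δ (toℕ i) (toℕ j)) → detᶠ n M ≈ 1#
  detᶠ-identity n M M≈δ = trans (detᶠ≈det n M δ M≈δ) (det-δ n)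

  detᶠ-mul : ∀ n (X Y : Fin n → Fin n → Carrier) →
             detᶠ n (λ i j → ∑ᶠ λ k → X i k * Y k j) ≈ detᶠ n X * detᶠ n Y
  detᶠ-mul n X Y = begin
    detᶠ n (λ i j → ∑ᶠ λ k → X i k * Y k j)   ≈⟨ detᶠ≈det n _ (mul n (toMat X) (toMat Y)) entries ⟩
    det n (mul n (toMat X) (toMat Y))         ≈⟨ det-mul n (toMat X) (toMat Y) ⟩
    det n (toMat X) * det n (toMat Y)         ≈⟨ *-cong (detᶠ≈det-toMat n X) (detᶠ≈det-toMat n Y) ⟨
    detᶠ n X * detᶠ n Y                       ∎
    where
      entries : ∀ i j → ∑ᶠ (λ k → X i k * Y k j) ≈ mul n (toMat X) (toMat Y) (toℕ i) (toℕ j)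
      entries i j = ∑ᶠ≈∑ n _ _ λ k → *-cong (toMat-toℕ X i k) (toMat-toℕ Y k j)

module Polynomial {c ℓ : Level} (R : RawRing c ℓ) where
  open Poly R

  commutativeRing : Set → CommutativeRing c (c ⊔ ℓ)
  commutativeRing A = record { isCommutativeRing = isCommutativeRing }
    where
      ⊗-identityˡ : ∀ (p : Expr A) → con (RawRing.1# R) ⊗ p ≃ p
      ⊗-identityˡ p = ≃-trans (⊗-comm _ p) (⊗-idʳ p)
      isCommutativeRing : IsCommutativeRing _≃_ _⊕_ _⊗_ ⊖_ (con (RawRing.0# R)) (con (RawRing.1# R))
      isCommutativeRing = record
        { isRing = record
          { +-isAbelianGroup = record
            { isGroup = record
              { isMonoid = record
                { isSemigroup = record
                  { isMagma = record
                    { isEquivalence = record { refl = ≃-refl ; sym = ≃-sym ; trans = ≃-trans }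
                    ; ∙-cong = ⊕-cong }
                  ; assoc = ⊕-assoc }
                ; identity = (λ p → ≃-trans (⊕-comm _ p) (⊕-idʳ p)) , ⊕-idʳ }
              ; inverse = (λ p → ≃-trans (⊕-comm (⊖ p) p) (⊖-invʳ p)) , ⊖-invʳ
              ; ⁻¹-cong = ⊖-cong }
            ; comm = ⊕-comm }
          ; *-cong = ⊗-cong
          ; *-assoc = ⊗-assoc
          ; *-identity = ⊗-identityˡ , ⊗-idʳ
          ; distrib = distribˡ , λ p q r → ≃-trans (⊗-comm (q ⊕ r) p)
                                             (≃-trans (distribˡ p q r) (⊕-cong (⊗-comm p q) (⊗-comm p r))) }
        ; *-comm = ⊗-comm }

  sumE≡∑ᶠ : ∀ {A m} {f g : Fin m → Expr A} → (∀ i → f i ≡ g i) → sumE f ≡ Determinant.∑ᶠ (commutativeRing A) g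
  sumE≡∑ᶠ {m = zero}  f≡g = ≡.refl
  sumE≡∑ᶠ {m = suc m} f≡g = ≡.cong₂ _⊕_ (f≡g fzero) (sumE≡∑ᶠ (f≡g ∘ fsuc))

  det≡detᶠ : ∀ {A} n M → det {A} n M ≡ Determinant.detᶠ (commutativeRing A) n M
  det≡detᶠ {A} zero    M = ≡.refl
  det≡detᶠ {A} (suc n) M = sumE≡∑ᶠ λ j → signed≡signed (toℕ j) (≡.cong (M fzero j ⊗_) (det≡detᶠ n (minorᶠ j)))
    where
      minorᶠ : Fin (suc n) → Fin n → Fin n → Expr A
      minorᶠ j i k = M (fsuc i) (punchIn j k)
      open Determinant (commutativeRing A) using () renaming (signed to signedᴿ)
      signed≡signed : ∀ k {p q} → p ≡ q → signed k p ≡ signedᴿ k q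
      signed≡signed zero    p≡q = p≡q
      signed≡signed (suc k) p≡q = ≡.cong ⊖_ (signed≡signed k p≡q)

  module _ {A B : Set} (σ : A → Expr B) where

    substE-cong : ∀ {p q} → p ≃ q → substE σ p ≃ substE σ q
    substE-cong ≃-refl              = ≃-refl
    substE-cong (≃-sym e)           = ≃-sym (substE-cong e)
    substE-cong (≃-trans e e′)      = ≃-trans (substE-cong e) (substE-cong e′)
    substE-cong (⊕-cong e e′)       = ⊕-cong (substE-cong e) (substE-cong e′)
    substE-cong (⊗-cong e e′)       = ⊗-cong (substE-cong e) (substE-cong e′)
    substE-cong (⊖-cong e)          = ⊖-cong (substE-cong e)
    substE-cong (⊕-assoc p q r)     = ⊕-assoc _ _ _
    substE-cong (⊕-comm p q)        = ⊕-comm _ _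
    substE-cong (⊕-idʳ p)           = ⊕-idʳ _
    substE-cong (⊖-invʳ p)          = ⊖-invʳ _
    substE-cong (⊗-assoc p q r)     = ⊗-assoc _ _ _
    substE-cong (⊗-comm p q)        = ⊗-comm _ _
    substE-cong (⊗-idʳ p)           = ⊗-idʳ _
    substE-cong (distribˡ p q r)    = distribˡ _ _ _
    substE-cong (con-cong e)        = con-cong e
    substE-cong (con-+ a b)         = con-+ a b
    substE-cong (con-* a b)         = con-* a b
    substE-cong (con-neg a)         = con-neg a

    substE-det : ∀ n M → substE σ (det n M) ≡ det n (λ i j → substE σ (M i j))
    substE-det zero    M = ≡.refl
    substE-det (suc n) M = substE-sumE {f = λ j → signed (toℕ j) (M fzero j ⊗ det n (minorᶠ j))} λ j →
      ≡.trans (substE-signed (toℕ j)) (≡.cong (λ d → signed (toℕ j) (substE σ (M fzero j) ⊗ d)) (substE-det n (minorᶠ j)))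
      where
        minorᶠ : Fin (suc n) → Fin n → Fin n → Expr A
        minorᶠ j i k = M (fsuc i) (punchIn j k)
        substE-sumE : ∀ {m} {f : Fin m → Expr A} {g : Fin m → Expr B} →
                      (∀ i → substE σ (f i) ≡ g i) → substE σ (sumE f) ≡ sumE g
        substE-sumE {zero}          _  = ≡.refl
        substE-sumE {suc m} {f} {g} eq = ≡.cong₂ _⊕_ (eq fzero) (substE-sumE {f = f ∘ fsuc} {g ∘ fsuc} (eq ∘ fsuc))
        substE-signed : ∀ k {p} → substE σ (signed k p) ≡ signed k (substE σ p)
        substE-signed zero    = ≡.refl
        substE-signed (suc k) = ≡.cong ⊖_ (substE-signed k)

  substE-detPoly : ∀ {B} n (σ : Fin n × Fin n → Expr B) → substE σ (detPoly n) ≡ det n (λ i j → σ (i , j))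
  substE-detPoly n σ = substE-det σ n _

  substE-pointwise : ∀ {A B} {σ τ : A → Expr B} → (∀ a → σ a ≃ τ a) → ∀ p → substE σ p ≃ substE τ p
  substE-pointwise σ≃τ (var x) = σ≃τ x
  substE-pointwise σ≃τ (con a) = ≃-refl
  substE-pointwise σ≃τ (p ⊕ q) = ⊕-cong (substE-pointwise σ≃τ p) (substE-pointwise σ≃τ q)
  substE-pointwise σ≃τ (p ⊗ q) = ⊗-cong (substE-pointwise σ≃τ p) (substE-pointwise σ≃τ q)
  substE-pointwise σ≃τ (⊖ p)   = ⊖-cong (substE-pointwise σ≃τ p)

  substE-substE : ∀ {A B C} (σ : A → Expr B) (τ : B → Expr C) p →
                  substE τ (substE σ p) ≡ substE (substE τ ∘ σ) p
  substE-substE σ τ (var x) = ≡.refl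
  substE-substE σ τ (con a) = ≡.refl
  substE-substE σ τ (p ⊕ q) = ≡.cong₂ _⊕_ (substE-substE σ τ p) (substE-substE σ τ q)
  substE-substE σ τ (p ⊗ q) = ≡.cong₂ _⊗_ (substE-substE σ τ p) (substE-substE σ τ q)
  substE-substE σ τ (⊖ p)   = ≡.cong ⊖_ (substE-substE σ τ p)

module CoefficientChange {c ℓ c′ ℓ′ : Level} {R : RawRing c ℓ} {S : RawRing c′ ℓ′}
  (φ : RawRing.Carrier R → RawRing.Carrier S)
  (φ-0# : RawRing._≈_ S (φ (RawRing.0# R)) (RawRing.0# S))
  (φ-1# : RawRing._≈_ S (φ (RawRing.1# R)) (RawRing.1# S)) where
  private
    module R = Poly R
  open Poly S

  mapCoeff-det : ∀ {A} n (M : Fin n → Fin n → R.Expr A) →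
                 mapCoeff φ (R.det n M) ≃ det n (λ i j → mapCoeff φ (M i j))
  mapCoeff-det         zero    M = con-cong φ-1#
  mapCoeff-det {A = A} (suc n) M =
    mapCoeff-sumE {f = λ j → R.signed (toℕ j) (M fzero j R.⊗ R.det n (minorᶠ j))} λ j →
      mapCoeff-signed (toℕ j) (⊗-cong ≃-refl (mapCoeff-det n (minorᶠ j)))
    where
      minorᶠ : Fin (suc n) → Fin n → Fin n → R.Expr A
      minorᶠ j i k = M (fsuc i) (punchIn j k)
      mapCoeff-sumE : ∀ {m} {f : Fin m → R.Expr A} {g : Fin m → Expr A} →
                      (∀ i → mapCoeff φ (f i) ≃ g i) → mapCoeff φ (R.sumE f) ≃ sumE g
      mapCoeff-sumE {zero}          _  = con-cong φ-0#
      mapCoeff-sumE {suc m} {f} {g} eq = ⊕-cong (eq fzero) (mapCoeff-sumE {f = f ∘ fsuc} {g ∘ fsuc} (eq ∘ fsuc))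
      mapCoeff-signed : ∀ k {p q} → mapCoeff φ p ≃ q → mapCoeff φ (R.signed k p) ≃ signed k q
      mapCoeff-signed zero    eq = eq
      mapCoeff-signed (suc k) eq = ⊖-cong (mapCoeff-signed k eq)

module CircuitOutput {c ℓ : Level} (R : CommutativeRing c ℓ) where
  open CommutativeRing R
  open import Algebra.Properties.Ring ring using (-1*x≈-x)
  open import Algebra.Properties.CommutativeSemigroup +-commutativeSemigroup using (interchange)
  open import Algebra.Properties.CommutativeSemigroup *-commutativeSemigroup using (x∙yz≈y∙xz)
  open import Relation.Binary.Reasoning.Setoid setoid

  -- The value of the output gate. Its constants 1 and −1 enter as con (κ 1#) and con (κ (- 1#)),
  -- which in general equal 1# and - 1# only up to ≈, so they are kept as parameters u and m.
  output : (u m a d e : Carrier) → Carrier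
  output u m a d e = u + (u * (a * (d * 1#)) + (m * e + 0#))

  output-cong : ∀ u m a {d d′ e e′} → d ≈ d′ → e ≈ e′ → output u m a d e ≈ output u m a d′ e′
  output-cong u m a d≈d′ e≈e′ = +-congˡ (+-cong (*-congˡ (*-congˡ (*-congʳ d≈d′))) (+-congʳ (*-congˡ e≈e′)))

  output-normal : ∀ m a d e → m ≈ - 1# → output 1# m a d e ≈ 1# + (a * d - e)
  output-normal m a d e m≈-1 = +-congˡ (+-cong (trans (*-identityˡ _) (*-congˡ (*-identityʳ d)))
                                                (trans (+-identityʳ _) (trans (*-congʳ m≈-1) (-1*x≈-x e))))

  output-vanishes : ∀ m a d e → m ≈ - 1# → a ≈ 0# → e ≈ 1# → output 1# m a d e ≈ 0#
  output-vanishes m a d e m≈-1 a≈0 e≈1 = begin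
    output 1# m a d e     ≈⟨ output-normal m a d e m≈-1 ⟩
    1# + (a * d - e)      ≈⟨ +-congˡ (+-cong (trans (*-congʳ a≈0) (zeroˡ d)) (-‿cong e≈1)) ⟩
    1# + (0# - 1#)        ≈⟨ +-congˡ (+-identityˡ _) ⟩
    1# - 1#               ≈⟨ -‿inverseʳ 1# ⟩
    0#                    ∎

  output-one : ∀ m a d e → m ≈ - 1# → e ≈ a * d → output 1# m a d e ≈ 1#
  output-one m a d e m≈-1 e≈ad = begin
    output 1# m a d e     ≈⟨ output-normal m a d e m≈-1 ⟩
    1# + (a * d - e)      ≈⟨ +-congˡ (+-congˡ (-‿cong e≈ad)) ⟩
    1# + (a * d - a * d)  ≈⟨ +-congˡ (-‿inverseʳ _) ⟩
    1# + 0#               ≈⟨ +-identityʳ 1# ⟩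
    1#                    ∎

  output-perturbation : ∀ u m a d e g g′ x →
    output u m a (d + x * g) (e + x * g′) ≈ output u m a d e + x * (u * (a * (g * 1#)) + m * g′)
  output-perturbation u m a d e g g′ x = begin
    u + (u * (a * ((d + x * g) * 1#)) + (m * (e + x * g′) + 0#))
      ≈⟨ +-congˡ (+-cong oracle₁ (trans (+-identityʳ _) oracle₂)) ⟩
    u + ((p + x * q) + (r + x * s))
      ≈⟨ +-congˡ (interchange p (x * q) r (x * s)) ⟩
    u + ((p + r) + (x * q + x * s))
      ≈⟨ +-assoc _ _ _ ⟨
    (u + (p + r)) + (x * q + x * s)
      ≈⟨ +-cong (+-congˡ (+-congˡ (+-identityʳ r))) (distribˡ x q s) ⟨
    output u m a d e + x * (q + s) ∎
    where
      p = u * (a * (d * 1#))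
      q = u * (a * (g * 1#))
      r = m * e
      s = m * g′
      oracle₁ : u * (a * ((d + x * g) * 1#)) ≈ p + x * q
      oracle₁ = begin
        u * (a * ((d + x * g) * 1#))      ≈⟨ *-congˡ (*-congˡ (distribʳ 1# d (x * g))) ⟩
        u * (a * (d * 1# + x * g * 1#))   ≈⟨ trans (*-congˡ (distribˡ a _ _)) (distribˡ u _ _) ⟩
        p + u * (a * (x * g * 1#))        ≈⟨ +-congˡ (*-congˡ (trans (*-congˡ (*-assoc x g 1#)) (x∙yz≈y∙xz a x _))) ⟩
        p + u * (x * (a * (g * 1#)))      ≈⟨ +-congˡ (x∙yz≈y∙xz u x _) ⟩
        p + x * q                         ∎
      oracle₂ : m * (e + x * g′) ≈ r + x * s
      oracle₂ = trans (distribˡ m e _) (+-congˡ (x∙yz≈y∙xz m x g′))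

open CircuitOutput using (output)

module RefutationCircuit {c ℓ : Level} (F : Field c ℓ) (n : ℕ) where
  open Field F using (Carrier; 1#; -_)
  open Circuits Carrier n (Prop87.Vars F n) public

  varY varZ : Fin n → Fin n → Prop87.Vars F n
  varY i j = inj₁ (inj₂ (i , j))
  varZ i j = inj₂ (inj₂ (i , j))

  varDet : Prop87.Vars F n
  varDet = inj₂ (inj₁ tt)

  diagonalGates : ∀ k → (Fin k → Fin n) → Gates k
  diagonalGates zero    f = []
  diagonalGates (suc k) f = add 1# ((1# , inj₂ (varZ (f fzero) (f fzero))) ∷ []) ∷ diagonalGates k (f ∘ fsuc)

  -- Diagonal gate i is gate i + 2 of lowerGates.
  entryI+Z : (i j : Fin n) → Dec (i ≡ j) → Input (suc (suc n))
  entryI+Z i j (yes _) = inj₁ (fsuc (fsuc i))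
  entryI+Z i j (no  _) = inj₂ (varZ i j)

  lowerGates : Gates (suc (suc n))
  lowerGates = mul (inj₂ varDet ∷ inj₁ fzero ∷ []) ∷ orc (λ i j → inj₂ (varY i j)) ∷ diagonalGates n id

  -- The output gate computes 1 + Zdet · det Y − det (I + Z).
  gates : Gates (suc (suc (suc (suc n))))
  gates = add 1# ((1# , inj₁ (fsuc fzero)) ∷ (- 1# , inj₁ fzero) ∷ [])
        ∷ orc (λ i j → entryI+Z i j (i ≟ j))
        ∷ lowerGates

  circuit : Circuit
  circuit = record { gates = gates ; output = inj₁ fzero }

  maxFin-lub : ∀ {m} (f : Fin m → ℕ) {b} → (∀ i → f i ≤ b) → maxFin f ≤ b
  maxFin-lub {zero}  f f≤b = z≤n
  maxFin-lub {suc m} f f≤b = ℕₚ.⊔-lub (f≤b fzero) (maxFin-lub (f ∘ fsuc) (f≤b ∘ fsuc))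

  diagonalGates-depth : ∀ k f t → depths (diagonalGates k f) t ≡ 1
  diagonalGates-depth (suc k) f fzero    = ≡.refl
  diagonalGates-depth (suc k) f (fsuc t) = diagonalGates-depth k (f ∘ fsuc) t

  depth-detY : depths gates (fsuc (fsuc (fsuc fzero))) ≤ 1
  depth-detY = s≤s (maxFin-lub {n} _ λ _ → maxFin-lub {n} _ λ _ → z≤n)

  depth-mul : depths gates (fsuc (fsuc fzero)) ≤ 2
  depth-mul = s≤s (ℕₚ.⊔-lub z≤n (ℕₚ.⊔-lub depth-detY z≤n))

  depth-detI+Z : depths gates (fsuc fzero) ≤ 2
  depth-detI+Z = s≤s (maxFin-lub {n} _ λ i → maxFin-lub {n} _ λ j → entry-depth i j (i ≟ j))
    where
      entry-depth : ∀ i j i≟j → inDepth (depths lowerGates) (entryI+Z i j i≟j) ≤ 1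
      entry-depth i j (yes _) = ℕₚ.≤-reflexive (diagonalGates-depth n id i)
      entry-depth i j (no  _) = z≤n

  depth-output : depths gates fzero ≤ 3
  depth-output = s≤s (ℕₚ.⊔-lub depth-mul (ℕₚ.⊔-lub depth-detI+Z z≤n))

  gates-depth : ∀ t → depths gates t ≤ 3
  gates-depth fzero                            = depth-output
  gates-depth (fsuc fzero)                     = ℕₚ.m≤n⇒m≤1+n depth-detI+Z
  gates-depth (fsuc (fsuc fzero))              = ℕₚ.m≤n⇒m≤1+n depth-mul
  gates-depth (fsuc (fsuc (fsuc fzero)))       = ℕₚ.≤-trans depth-detY (s≤s z≤n)
  gates-depth (fsuc (fsuc (fsuc (fsuc t))))    = ℕₚ.≤-trans (ℕₚ.≤-reflexive (diagonalGates-depth n id t)) (s≤s z≤n)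

  depth≤3 : depth circuit ≤ 3
  depth≤3 = ℕₚ.⊔-lub (maxFin-lub _ gates-depth) depth-output

  diagonalGates-wires : ∀ k f → gatesWires (diagonalGates k f) ≡ k
  diagonalGates-wires zero    f = ≡.refl
  diagonalGates-wires (suc k) f = ≡.cong suc (diagonalGates-wires k (f ∘ fsuc))

  wires≤ : wires circuit ≤ 5 *ℕ n ^ 2 +ℕ 5
  wires≤ = begin
    wires circuit                  ≡⟨ ≡.cong (λ w → 2 +ℕ (n² +ℕ (2 +ℕ (n² +ℕ w)))) (diagonalGates-wires n id) ⟩
    2 +ℕ (n² +ℕ (2 +ℕ (n² +ℕ n)))  ≤⟨ count≤ n² n (n≤n*n n) ⟩
    5 *ℕ n² +ℕ 5                   ≡⟨ ≡.cong (λ m → 5 *ℕ (n *ℕ m) +ℕ 5) (ℕₚ.*-identityʳ n) ⟨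
    5 *ℕ n ^ 2 +ℕ 5                ∎
    where
      open ℕₚ.≤-Reasoning
      n² = n *ℕ n
      n≤n*n : ∀ n → n ≤ n *ℕ n
      n≤n*n zero    = z≤n
      n≤n*n (suc n) = ℕₚ.m≤m*n (suc n) (suc n)
      count≤ : ∀ m k → k ≤ m → 2 +ℕ (m +ℕ (2 +ℕ (m +ℕ k))) ≤ 5 *ℕ m +ℕ 5
      count≤ m k k≤m = begin
        2 +ℕ (m +ℕ (2 +ℕ (m +ℕ k)))          ≡⟨ reorder m k ⟩
        k +ℕ (2 *ℕ m +ℕ 4)                   ≤⟨ ℕₚ.+-monoˡ-≤ (2 *ℕ m +ℕ 4) k≤m ⟩
        m +ℕ (2 *ℕ m +ℕ 4)                   ≤⟨ ℕₚ.m≤m+n _ (2 *ℕ m +ℕ 1) ⟩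
        m +ℕ (2 *ℕ m +ℕ 4) +ℕ (2 *ℕ m +ℕ 1)  ≡⟨ total m ⟩
        5 *ℕ m +ℕ 5                          ∎
        where
          reorder : ∀ m k → 2 +ℕ (m +ℕ (2 +ℕ (m +ℕ k))) ≡ k +ℕ (2 *ℕ m +ℕ 4)
          reorder = solve-∀
          total : ∀ m → m +ℕ (2 *ℕ m +ℕ 4) +ℕ (2 *ℕ m +ℕ 1) ≡ 5 *ℕ m +ℕ 5
          total = solve-∀

  module Evaluation {c′ ℓ′} (S : RawRing c′ ℓ′) (κ : Carrier → RawRing.Carrier S)
                    (h : Poly.Expr S (Fin n × Fin n)) where
    open Semantics S κ h public
    open Poly S

    onePlusZ : Fin n → Expr (Prop87.Vars F n)
    onePlusZ i = con (κ 1#) ⊕ ((con (κ 1#) ⊗ var (varZ i i)) ⊕ con (RawRing.0# S))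

    diagonalGates-value : ∀ k f t → values (diagonalGates k f) t ≡ onePlusZ (f t)
    diagonalGates-value (suc k) f fzero    = ≡.refl
    diagonalGates-value (suc k) f (fsuc t) = diagonalGates-value k (f ∘ fsuc) t

    entry : Fin n → Fin n → Expr (Prop87.Vars F n)
    entry i j = inVal (values lowerGates) (entryI+Z i j (i ≟ j))

    σY σI+Z : Fin n × Fin n → Expr (Prop87.Vars F n)
    σY (i , j) = var (varY i j)
    σI+Z (i , j) = entry i j

    computes-circuit : computes circuit ≡
      output (Polynomial.commutativeRing S (Prop87.Vars F n)) (con (κ 1#)) (con (κ (- 1#))) (var varDet)
             (substE σY h) (substE σI+Z h)
    computes-circuit = ≡.refl

module IPSRefutation {c ℓ : Level} (F : Field c ℓ) (n : ℕ) where
  open Field F using (rawRing) renaming (1# to 1F; 0# to 0F)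
  open Poly rawRing
  open Polynomial rawRing
  open RefutationCircuit F n
  open Evaluation rawRing id (detPoly n)
  open CommutativeRing (commutativeRing (XYVar n))
    using (_≈_; _+_; _*_; -_; _-_; 0#; 1#; +-congˡ; +-identityʳ; zeroʳ; *-identityˡ; -‿inverseˡ; +-comm; +-assoc; setoid)
    renaming (refl to ≈-refl; reflexive to ≈-reflexive; trans to ≈-trans)
  open Determinant (commutativeRing (XYVar n))
    using (detᶠ; detᶠ-cong; detᶠ-identity; detᶠ-mul; δ; δ-diagonal; δ-offDiagonal; ∑ᶠ)
  open CircuitOutput (commutativeRing (XYVar n)) using (output-vanishes; output-one)
  open import Algebra.Properties.Ring (CommutativeRing.ring (commutativeRing (XYVar n))) using (-0#≈0#)
  open import Relation.Binary.Reasoning.Setoid setoid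

  refutation : Expr (Prop87.Vars F n)
  refutation = computes circuit

  substE-oracle : ∀ (σ : Fin n × Fin n → Expr (Prop87.Vars F n)) (τ : Prop87.Vars F n → Expr (XYVar n)) →
                  substE τ (substE σ (detPoly n)) ≡ detᶠ n (λ i j → substE τ (σ (i , j)))
  substE-oracle σ τ = ≡.trans (substE-substE σ τ (detPoly n)) (≡.trans (substE-detPoly n _) (det≡detᶠ n _))

  toℕ-≢ : ∀ {i j : Fin n} → i ≢ j → toℕ i ≢ toℕ j
  toℕ-≢ i≢j = i≢j ∘ Finₚ.toℕ-injective

  τ₀ : Prop87.Vars F n → Expr (XYVar n)
  τ₀ = [ var , (λ _ → con 0F) ]

  entry-τ₀ : ∀ i j → substE τ₀ (entry i j) ≈ δ (toℕ i) (toℕ j)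
  entry-τ₀ i j with i ≟ j
  ... | yes ≡.refl = begin
    substE τ₀ (values (diagonalGates n id) i)  ≡⟨ ≡.cong (substE τ₀) (diagonalGates-value n id i) ⟩
    1# + (1# * 0# + 0#)                       ≈⟨ +-congˡ (≈-trans (+-identityʳ _) (zeroʳ 1#)) ⟩
    1# + 0#                                   ≈⟨ +-identityʳ 1# ⟩
    1#                                        ≡⟨ δ-diagonal (toℕ i) ⟨
    δ (toℕ i) (toℕ i)                         ∎
  ... | no  i≢j    = ≈-reflexive (≡.sym (δ-offDiagonal (toℕ-≢ i≢j)))

  vanishes : substE τ₀ refutation ≈ 0#
  vanishes = output-vanishes _ _ _ _ (con-neg 1F) ≈-refl
    (≈-trans (≈-reflexive (substE-oracle _ τ₀)) (detᶠ-identity n _ entry-τ₀))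

  δˢ-diagonal : ∀ i → DetSystem.δ rawRing n i i ≡ con 1F
  δˢ-diagonal i with i ≟ i
  ... | yes _   = ≡.refl
  ... | no  i≢i = ⊥-elim (i≢i ≡.refl)

  δˢ-offDiagonal : ∀ {i j} → i ≢ j → DetSystem.δ rawRing n i j ≡ con 0F
  δˢ-offDiagonal {i} {j} i≢j with i ≟ j
  ... | yes i≡j = ⊥-elim (i≢j i≡j)
  ... | no  _   = ≡.refl

  τ₁ : Prop87.Vars F n → Expr (XYVar n)
  τ₁ = [ var , DetSystem.system rawRing n ]

  X Y XY : Fin n → Fin n → Expr (XYVar n)
  X i j = var (inj₁ (i , j))
  Y i j = var (inj₂ (i , j))
  XY i j = ∑ᶠ (λ k → X i k * Y k j)

  entry-τ₁ : ∀ i j → substE τ₁ (entry i j) ≈ XY i j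
  entry-τ₁ i j with i ≟ j
  ... | yes ≡.refl = begin
    substE τ₁ (values (diagonalGates n id) i)   ≡⟨ ≡.cong (substE τ₁) (diagonalGates-value n id i) ⟩
    1# + (1# * (S ⊕ ⊖ DetSystem.δ rawRing n i i) + 0#)
      ≡⟨ ≡.cong (λ d → 1# + (1# * (S ⊕ ⊖ d) + 0#)) (δˢ-diagonal i) ⟩
    1# + (1# * (S - 1#) + 0#)                  ≈⟨ +-congˡ (≈-trans (+-identityʳ _) (*-identityˡ _)) ⟩
    1# + (S - 1#)                              ≈⟨ +-comm 1# _ ⟩
    (S - 1#) + 1#                              ≈⟨ +-assoc S (- 1#) 1# ⟩
    S + (- 1# + 1#)                            ≈⟨ +-congˡ (-‿inverseˡ 1#) ⟩
    S + 0#                                     ≈⟨ +-identityʳ S ⟩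
    S                                          ≡⟨ sumE≡∑ᶠ (λ _ → ≡.refl) ⟩
    XY i i                                     ∎
    where S = sumE (λ k → X i k ⊗ Y k i)
  ... | no  i≢j    = begin
    sumE (λ k → X i k ⊗ Y k j) ⊕ ⊖ DetSystem.δ rawRing n i j
      ≡⟨ ≡.cong (λ d → sumE (λ k → X i k ⊗ Y k j) ⊕ ⊖ d) (δˢ-offDiagonal i≢j) ⟩
    sumE (λ k → X i k ⊗ Y k j) + - 0#                        ≈⟨ ≈-trans (+-congˡ -0#≈0#) (+-identityʳ _) ⟩
    sumE (λ k → X i k ⊗ Y k j)                               ≡⟨ sumE≡∑ᶠ (λ _ → ≡.refl) ⟩
    XY i j                                                   ∎

  one : substE τ₁ refutation ≈ 1#
  one = output-one _ _ _ _ (con-neg 1F) (begin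
    substE τ₁ (substE σI+Z (detPoly n))                     ≡⟨ substE-oracle _ τ₁ ⟩
    detᶠ n (λ i j → substE τ₁ (entry i j))                  ≈⟨ detᶠ-cong n entry-τ₁ ⟩
    detᶠ n XY                                               ≈⟨ detᶠ-mul n X Y ⟩
    detᶠ n X * detᶠ n Y                                     ≡⟨ ≡.cong₂ _*_ (det≡detᶠ n X) (substE-oracle _ τ₁) ⟨
    det n X * substE τ₁ (substE σY (detPoly n))             ∎)

  isRefutation : IPS.IsIPSRefutation rawRing (DetSystem.system rawRing n) refutation
  isRefutation = vanishes , one

module ApproximateOracle {c ℓ : Level} (F : Field c ℓ) (n : ℕ) where
  open Field F using (rawRing) renaming (1# to 1F; 0# to 0F; -_ to -F_; refl to ≈F-refl)
  open PowerSeries F using (PSRing; ε; ι)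
  open Poly PSRing
  open Polynomial PSRing using (commutativeRing; substE-cong; substE-detPoly; substE-pointwise)
  open RefutationCircuit F n
  private
    module E = Evaluation rawRing id (Poly.detPoly rawRing n)
  open CommutativeRing (commutativeRing (Prop87.Vars F n)) using (setoid)
  open import Relation.Binary.Reasoning.Setoid setoid

  ι-0# : RawRing._≈_ PSRing (ι 0F) (RawRing.0# PSRing)
  ι-0# zero    = ≈F-refl
  ι-0# (suc _) = ≈F-refl

  ι-1# : RawRing._≈_ PSRing (ι 1F) (RawRing.1# PSRing)
  ι-1# zero    = ≈F-refl
  ι-1# (suc _) = ≈F-refl

  open CoefficientChange {R = rawRing} {S = PSRing} ι ι-0# ι-1# using (mapCoeff-det)

  mapCoeff-oracle : ∀ (σᴿ : Fin n × Fin n → Poly.Expr rawRing (Prop87.Vars F n)) σ →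
    (∀ p → mapCoeff ι (σᴿ p) ≃ σ p) →
    mapCoeff ι (Poly.substE rawRing σᴿ (Poly.detPoly rawRing n)) ≃ substE σ (detPoly n)
  mapCoeff-oracle σᴿ σ σᴿ≃σ = begin
    mapCoeff ι (Poly.substE rawRing σᴿ (Poly.detPoly rawRing n))
      ≡⟨ ≡.cong (mapCoeff ι) (Polynomial.substE-detPoly rawRing n σᴿ) ⟩
    mapCoeff ι (Poly.det rawRing n (λ i j → σᴿ (i , j)))
      ≈⟨ mapCoeff-det n _ ⟩
    det n (λ i j → mapCoeff ι (σᴿ (i , j)))
      ≡⟨ substE-detPoly n _ ⟨
    substE (mapCoeff ι ∘ σᴿ) (detPoly n)
      ≈⟨ substE-pointwise σᴿ≃σ (detPoly n) ⟩
    substE σ (detPoly n) ∎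

  module _ (h g : Expr (Fin n × Fin n)) (h≃det+εg : h ≃ detPoly n ⊕ con ε ⊗ g) where
    open Evaluation PSRing ι h
    open CircuitOutput (commutativeRing (Prop87.Vars F n)) using (output-cong; output-perturbation)

    outputᴾ : Expr (Prop87.Vars F n) → Expr (Prop87.Vars F n) → Expr (Prop87.Vars F n)
    outputᴾ = output (commutativeRing (Prop87.Vars F n)) (con (ι 1F)) (con (ι (-F 1F))) (var varDet)

    mapCoeff-entry : ∀ i j → mapCoeff ι (E.entry i j) ≃ entry i j
    mapCoeff-entry i j with i ≟ j
    ... | yes ≡.refl = begin
      mapCoeff ι (E.values (diagonalGates n id) i)  ≡⟨ ≡.cong (mapCoeff ι) (E.diagonalGates-value n id i) ⟩
      mapCoeff ι (E.onePlusZ i)                     ≈⟨ ⊕-cong ≃-refl (⊕-cong ≃-refl (con-cong ι-0#)) ⟩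
      onePlusZ i                                    ≡⟨ diagonalGates-value n id i ⟨
      values (diagonalGates n id) i                 ∎
    ... | no  _      = ≃-refl

    mapCoeff-refutation : mapCoeff ι (IPSRefutation.refutation F n) ≃ outputᴾ (substE σY (detPoly n)) (substE σI+Z (detPoly n))
    mapCoeff-refutation =
      ⊕-cong ≃-refl (⊕-cong (⊗-cong ≃-refl (⊗-cong ≃-refl (⊗-cong detY (con-cong ι-1#))))
                            (⊕-cong (⊗-cong ≃-refl detI+Z) (con-cong ι-0#)))
      where
        detY = mapCoeff-oracle E.σY σY λ _ → ≃-refl
        detI+Z = mapCoeff-oracle E.σI+Z σI+Z λ (i , j) → mapCoeff-entry i j

    g′ : Expr (Prop87.Vars F n)
    g′ = con (ι 1F) ⊗ (var varDet ⊗ (substE σY g ⊗ con (RawRing.1# PSRing))) ⊕ con (ι (-F 1F)) ⊗ substE σI+Z g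

    approximates : computes circuit ≃ mapCoeff ι (IPSRefutation.refutation F n) ⊕ con ε ⊗ g′
    approximates = begin
      computes circuit
        ≡⟨ computes-circuit ⟩
      outputᴾ (substE σY h) (substE σI+Z h)
        ≈⟨ output-cong _ _ _ (substE-cong _ h≃det+εg) (substE-cong _ h≃det+εg) ⟩
      outputᴾ (substE σY (detPoly n) ⊕ con ε ⊗ substE σY g) (substE σI+Z (detPoly n) ⊕ con ε ⊗ substE σI+Z g)
        ≈⟨ output-perturbation _ _ _ _ _ _ _ _ ⟩
      outputᴾ (substE σY (detPoly n)) (substE σI+Z (detPoly n)) ⊕ con ε ⊗ g′
        ≈⟨ ⊕-cong mapCoeff-refutation ≃-refl ⟨
      mapCoeff ι (IPSRefutation.refutation F n) ⊕ con ε ⊗ g′ ∎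

proposition8p7 : {c ℓ : Level} (F : Field c ℓ) →
    Prop87.Claim1 F × Prop87.Claim2 F
proposition8p7 F =
  (5 , λ n → let open RefutationCircuit F n in
     circuit , depth≤3 , wires≤ , IPSRefutation.refutation F n , IPSRefutation.isRefutation F n , Poly.≃-refl) ,
  (5 , λ n h g h≃det+εg → let open RefutationCircuit F n in
     circuit , depth≤3 , wires≤ , IPSRefutation.refutation F n , IPSRefutation.isRefutation F n ,
     ApproximateOracle.g′ F n h g h≃det+εg , ApproximateOracle.approximates F n h g h≃det+εg)
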